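{- For all $n\ge0$ and $0\le k\le n$, $t_{n,k}(y,\boldsymbol{\phi})=\widetilde{t}_{n,k}(y,\boldsymbol{\phi})$.
   Context: Let $\boldsymbol{\phi}=(\phi_m)_{m\ge0}$ and $y$ be indeterminates and $\widehat{\phi}_m=m!\,\phi_m$. Rooted trees: for a rooted tree $T$ on a totally ordered vertex set, $j$ is a descendant of $i$ if the path from the root to $j$ passes through $i$ (including $j=i$); an edge $ij$ with $j$ a child of $i$ is improper if some descendant of $j$ is lower-numbered than $i$, proper otherwise; $\mathrm{pdeg}_T(i)$ is the number of children $j$ of $i$ with $ij$ proper, and $\mathrm{imprope}(T)$ the number of improper edges. With $\mathcal{T}^{\langle 1;k\rangle}_{n+1}$ the set of rooted trees on $[n+1]$ in which vertex $1$ has exactly $k$ children, $t_{n,k}(y,\boldsymbol{\phi})=\sum_{T\in\mathcal{T}^{\langle 1;k\rangle}_{n+1}} y^{\mathrm{imprope}(T)}\prod_{i=2}^{n+1}\widehat{\phi}_{\mathrm{pdeg}_T(i)}$. Partial functional digraphs: directed graphs (loops allowed) in which every vertex has out-degree $0$ or $1$; $\mathbf{PFD}_{n,k}$ is the set of those on $[n]$ with exactly $k$ vertices of out-degree $0$. A vertex is a predecessor of $j$ if there is a directed path from it to $j$ (every vertex is its own predecessor). An edge $\overrightarrow{ji}$ is improper if some predecessor of $j$ is $\le i$, proper otherwise. $\mathrm{pindeg}_G(i)$ is the number of proper edges $\overrightarrow{ji}$ into $i$, and $\mathrm{imprope}(G)$ the number of improper edges. Define $\widetilde{t}_{n,k}(y,\boldsymbol{\phi})=\sum_{G\in\mathbf{PFD}_{n,k}}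 y^{\mathrm{imprope}(G)}\prod_{i=1}^{n}\widehat{\phi}_{\mathrm{pindeg}_G(i)}$. -}

module Defs where

open import Level using (Level)
open import Algebra.Bundles using (CommutativeSemiring)
open import Data.Nat using (ℕ; zero; suc)
open import Data.Nat using (_!)
open import Data.Fin using (Fin; _<_; _≤_) renaming (zero to fzero; suc to fsuc)
open import Data.Fin.Properties using (_<?_; _≤?_) renaming (_≟_ to _≟F_)
open import Data.Maybe using (Maybe; nothing; just)
open import Data.Maybe.Properties using (≡-dec)
open import Data.Vec using (Vec; []; _∷_; lookup; toList)
open import Data.List using (List; []; _∷_; [_]; map; concatMap; allFin; upTo; filter; length; foldr)
open import Data.List.Relation.Unary.Any using (Any; any?)
open import Data.List.Relation.Unary.All using (All; all?)
open import Data.Product using (_×_)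
open import Relation.Nullary using (Dec; ¬_; ¬?)
open import Relation.Nullary.Decidable using (_×-dec_)
open import Relation.Binary.PropositionalEquality using (_≡_)

-- A vertex set [m] is represented by Fin m (label i+1 ↦ index i, order
-- preserved).  A map f : Fin m → Maybe (Fin m) (stored as a vector) is
--  * for rooted trees: the parent function (nothing = root);
--  * for partial functional digraphs: f j = just i means edge j → i,
--    f j = nothing means out-degree 0.

Fun : ℕ → Set
Fun m = Vec (Maybe (Fin m)) m

_≟M_ : ∀ {m} (x y : Maybe (Fin m)) → Dec (x ≡ y)
_≟M_ = ≡-dec _≟F_

step : ∀ {m} → Fun m → Maybe (Fin m) → Maybe (Fin m)
step f nothing  = nothing
step f (just x) = lookup f x

iter : ∀ {m} → Fun m → ℕ → Maybe (Fin m) → Maybe (Fin m)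
iter f zero    x = x
iter f (suc s) x = step f (iter f s x)

-- u reaches j by following f (0 or more steps; paths of length ≤ m suffice).
-- For a tree (f = parent): u is a descendant of j.
-- For a PFD: u is a predecessor of j.
Reaches : ∀ {m} → Fun m → Fin m → Fin m → Set
Reaches {m} f u j = Any (λ s → iter f s (just u) ≡ just j) (upTo (suc m))

reaches? : ∀ {m} (f : Fun m) u j → Dec (Reaches f u j)
reaches? f u j = any? (λ s → iter f s (just u) ≟M just j) _

allVecs : ∀ {A : Set} → List A → (n : ℕ) → List (Vec A n)
allVecs xs zero    = [ [] ]
allVecs xs (suc n) = concatMap (λ x → map (x ∷_) (allVecs xs n)) xs

allFuns : (m : ℕ) → List (Fun m)
allFuns m = allVecs (nothing ∷ map just (allFin m)) m

count : ∀ {A : Set} {P : A → Set} → (∀ x → Dec (P x)) → List A → ℕ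
count P? xs = length (filter P? xs)

nNothing : ∀ {m} → Fun m → ℕ
nNothing {m} f = count (λ j → lookup f j ≟M nothing) (allFin m)

nChildren : ∀ {m} → Fun m → Fin m → ℕ
nChildren {m} f i = count (λ j → lookup f j ≟M just i) (allFin m)

-- Rooted trees on [m]: exactly one root and no cycles
-- (every vertex falls off after m parent steps).

IsRootedTree : ∀ {m} → Fun m → Set
IsRootedTree {m} f = (nNothing f ≡ 1) × All (λ j → iter f m (just j) ≡ nothing) (allFin m)

isRootedTree? : ∀ {m} (f : Fun m) → Dec (IsRootedTree f)
isRootedTree? {m} f =
  (Data.Nat._≟_ (nNothing f) 1) ×-dec all? (λ j → iter f m (just j) ≟M nothing) (allFin m)

-- Tree edge ij (j child of i) is improper: some descendant of j is < i
TreeImproper : ∀ {m} → Fun m → Fin m → Fin m → Set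
TreeImproper {m} f i j = Any (λ d → Reaches f d j × d < i) (allFin m)

treeImproper? : ∀ {m} (f : Fun m) i j → Dec (TreeImproper f i j)
treeImproper? f i j = any? (λ d → reaches? f d j ×-dec (d <? i)) _

-- PFD edge j → i is improper: some predecessor of j is ≤ i
PFDImproper : ∀ {m} → Fun m → Fin m → Fin m → Set
PFDImproper {m} f i j = Any (λ p → Reaches f p j × p ≤ i) (allFin m)

pfdImproper? : ∀ {m} (f : Fun m) i j → Dec (PFDImproper f i j)
pfdImproper? f i j = any? (λ p → reaches? f p j ×-dec (p ≤? i)) _

pdegT : ∀ {m} → Fun m → Fin m → ℕ
pdegT {m} f i = count (λ j → (lookup f j ≟M just i) ×-dec ¬? (treeImproper? f i j)) (allFin m)

impropeT : ∀ {m} → Fun m → ℕ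
impropeT {m} f = foldr Data.Nat._+_ 0
  (map (λ i → count (λ j → (lookup f j ≟M just i) ×-dec treeImproper? f i j) (allFin m)) (allFin m))

pindegG : ∀ {m} → Fun m → Fin m → ℕ
pindegG {m} f i = count (λ j → (lookup f j ≟M just i) ×-dec ¬? (pfdImproper? f i j)) (allFin m)

impropeG : ∀ {m} → Fun m → ℕ
impropeG {m} f = foldr Data.Nat._+_ 0
  (map (λ i → count (λ j → (lookup f j ≟M just i) ×-dec pfdImproper? f i j) (allFin m)) (allFin m))

trees1k : (n k : ℕ) → List (Fun (suc n))
trees1k n k = filter (λ f → isRootedTree? f ×-dec Data.Nat._≟_ (nChildren f fzero) k) (allFuns (suc n))

pfds : (n k : ℕ) → List (Fun n)
pfds n k = filter (λ f → Data.Nat._≟_ (nNothing f) k) (allFuns n)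

-- The polynomials, evaluated in an arbitrary commutative semiring R
-- at y and φ = (φ_m)_m.  (An identity of polynomials with ℕ-coefficients
-- holds iff it holds under every such evaluation, R = ℕ[y,φ] included.)

module Poly {c ℓ : Level} (R : CommutativeSemiring c ℓ) where
  open CommutativeSemiring R

  _·_ : ℕ → Carrier → Carrier
  zero  · x = 0#
  suc n · x = x + (n · x)

  _^_ : Carrier → ℕ → Carrier
  x ^ zero  = 1#
  x ^ suc n = x * (x ^ n)

  prod : List Carrier → Carrier
  prod = foldr _*_ 1#

  sumR : List Carrier → Carrier
  sumR = foldr _+_ 0#

  phihat : (ℕ → Carrier) → ℕ → Carrier
  phihat φ m = (m !) · φ m

  -- t_{n,k}(y,φ): product over vertices 2..n+1 (indices fsuc i)
  t : ℕ → ℕ → Carrier → (ℕ → Carrier) → Carrier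
  t n k y φ = sumR (map (λ f → (y ^ impropeT f) *
                  prod (map (λ i → phihat φ (pdegT f (fsuc i))) (allFin n)))
                (trees1k n k))

  -- t̃_{n,k}(y,φ): product over all vertices 1..n
  tt : ℕ → ℕ → Carrier → (ℕ → Carrier) → Carrier
  tt n k y φ = sumR (map (λ G → (y ^ impropeG G) *
                  prod (map (λ i → phihat φ (pindegG G i)) (allFin n)))
                (pfds n k))

-- The identity comes from a weight-preserving bijection Ψ from PFD_{n,k} onto T^{⟨1;k⟩}_{n+1}; in
-- the encoding of Defs, vertex fzero of the tree is the vertex 1 and fsuc x is the PFD vertex x.
-- Given G, every sink of G becomes a child of 1, every edge off the cycles of G is kept, and the
-- cycles are strung together by their maxima c₁ < ⋯ < c_r: 1 is attached to c₁, the cycle edge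
-- entering cᵢ is redirected to c_{i+1}, and the one entering c_r is deleted, its tail becoming the
-- root.  The cycles thus become the path from 1 to the root.  Every edge of that path is improper
-- (1 lies below it), as is every cycle edge of G, and the edge out of 1 makes up for the deleted
-- one; off the path, an edge is proper in Ψ G iff it is proper in G.  So the number of improper
-- edges and every proper in-degree are preserved.  The inverse cuts the path from 1 to the root at
-- its left-to-right maxima and closes each piece into a cycle.

module Submission where

open import Defs
open import Algebra.Bundles using (CommutativeSemiring)
open import Data.Nat as ℕ using (ℕ; zero; suc; _+_; _∸_; _≤_; z≤n; s≤s; z<s)
import Data.Nat.Properties as ℕ
open import Data.Nat.Induction using (<-rec)
open import Data.Nat.ListAction using (sum)
open import Algebra.Properties.CommutativeSemigroup ℕ.+-commutativeSemigroup using (interchange)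
open import Data.Fin as Fin using (Fin; toℕ) renaming (zero to fzero; suc to fsuc)
import Data.Fin.Properties as Fin
import Data.Fin.Induction as Fin
open import Induction.WellFounded using (module All)
open import Data.Maybe as Maybe using (Maybe; nothing; just; fromMaybe)
open import Data.Maybe.Properties using (just-injective)
open import Data.Vec using (Vec; []; _∷_; lookup; tabulate)
import Data.Vec.Properties as Vec
open import Data.List using (List; []; _∷_; _++_; allFin; map; concatMap; cartesianProductWith)
import Data.List.Properties as List
open import Data.List.Relation.Unary.All as All using ([]; _∷_)
open import Data.List.Relation.Unary.Any using (Any; here; there; any?; satisfied)
open import Data.List.Relation.Unary.AllPairs using ([]; _∷_)
open import Data.List.Relation.Unary.Unique.Propositional using (Unique)
import Data.List.Relation.Unary.Unique.Propositional.Properties as Unique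
open import Data.List.Membership.Propositional using (_∈_; lose; find)
open import Data.List.Membership.Propositional.Properties
  using (∈-upTo⁺; ∈-allFin; ∈-map⁺; ∈-map⁻; ∈-filter⁺; ∈-filter⁻; ∈-cartesianProductWith⁺)
open import Data.List.Membership.Propositional.Properties.WithK using (unique∧set⇒bag)
open import Data.List.Relation.Binary.BagAndSetEquality using (∼bag⇒↭)
open import Data.List.Relation.Binary.Permutation.Propositional using (_↭_; ↭⇒↭ₛ′)
import Data.List.Relation.Binary.Permutation.Propositional.Properties as Permutation
import Data.List.Relation.Binary.Permutation.Setoid.Properties as PermutationSetoid
open import Data.Product using (∃; ∃₂; _×_; _,_; proj₁; proj₂)
open import Data.Sum using (_⊎_; inj₁; inj₂)
open import Data.Unit using (⊤; tt)
open import Data.Empty using (⊥-elim)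
open import Function using (_∘_; id; case_of_)
open import Function.Bundles using (mk⇔)
open import Relation.Binary using (tri<; tri≈; tri>)
open import Relation.Nullary using (¬_; Dec; yes; no; ¬?)
open import Relation.Nullary.Decidable using (_×-dec_; _⊎-dec_; _→-dec_; map′)
open import Relation.Binary.PropositionalEquality
  using (_≡_; _≢_; refl; sym; trans; cong; cong₂; subst; subst₂; module ≡-Reasoning)

nothing-or-just : ∀ {A : Set} (x : Maybe A) → x ≡ nothing ⊎ ∃ λ a → x ≡ just a
nothing-or-just nothing  = inj₁ refl
nothing-or-just (just a) = inj₂ (a , refl)

-- Walks

module _ {m : ℕ} (g : Fun m) where

  iter-nothing : ∀ s → iter g s nothing ≡ nothing
  iter-nothing zero    = refl
  iter-nothing (suc s) = cong (step g) (iter-nothing s)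

  iter-+ : ∀ a b x → iter g (a + b) x ≡ iter g a (iter g b x)
  iter-+ zero    b x = refl
  iter-+ (suc a) b x = cong (step g) (iter-+ a b x)

  iter-sucʳ : ∀ s x → iter g (suc s) x ≡ iter g s (step g x)
  iter-sucʳ s x = trans (cong (λ t → iter g t x) (ℕ.+-comm 1 s)) (iter-+ s 1 x)

  iter-+-cong : ∀ {a b} x → iter g a x ≡ iter g b x → ∀ c → iter g (c + a) x ≡ iter g (c + b) x
  iter-+-cong {a} {b} x eq c = begin
    iter g (c + a) x      ≡⟨ iter-+ c a x ⟩
    iter g c (iter g a x) ≡⟨ cong (iter g c) eq ⟩
    iter g c (iter g b x) ≡⟨ iter-+ c b x ⟨
    iter g (c + b) x      ∎
    where open ≡-Reasoning

  iter-nothing-≤ : ∀ {a s x} → a ℕ.≤ s → iter g a x ≡ nothing → iter g s x ≡ nothing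
  iter-nothing-≤ {a} {s} {x} a≤s e = begin
    iter g s x                  ≡⟨ cong (λ t → iter g t x) (ℕ.m∸n+n≡m a≤s) ⟨
    iter g (s ∸ a + a) x        ≡⟨ iter-+ (s ∸ a) a x ⟩
    iter g (s ∸ a) (iter g a x) ≡⟨ cong (iter g (s ∸ a)) e ⟩
    iter g (s ∸ a) nothing      ≡⟨ iter-nothing (s ∸ a) ⟩
    nothing                     ∎
    where open ≡-Reasoning

  iter-just-prefix : ∀ {a s x v} → a ℕ.≤ s → iter g s x ≡ just v → ∃ λ w → iter g a x ≡ just w
  iter-just-prefix {a} {s} {x} a≤s eq with iter g a x in e
  ... | just w  = w , refl
  ... | nothing with () ← trans (sym eq) (iter-nothing-≤ a≤s e)

  iter-periodic : ∀ {v s} → iter g (suc s) (just v) ≡ just v → ∀ k → iter g (k ℕ.* suc s) (just v) ≡ just v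
  iter-periodic         closed zero    = refl
  iter-periodic {v} {s} closed (suc k) =
    trans (iter-+ (suc s) (k ℕ.* suc s) (just v)) (trans (cong (iter g (suc s)) (iter-periodic closed k)) closed)

  walk-repeats : ∀ {u v} → iter g m (just u) ≡ just v →
                 ∃₂ λ i j → i ℕ.< j × j ℕ.≤ m × iter g i (just u) ≡ iter g j (just u)
  walk-repeats {u} {v} eq
    with i , j , i<j , same ← Fin.pigeonhole (ℕ.n<1+n m) (λ k → fromMaybe v (iter g (toℕ k) (just u))) =
    toℕ i , toℕ j , i<j , Fin.toℕ≤pred[n] j , trans (visited i) (trans (cong just same) (sym (visited j)))
    where
    visited : ∀ (k : Fin (suc m)) → iter g (toℕ k) (just u) ≡ just (fromMaybe v (iter g (toℕ k) (just u)))
    visited k with w , e ← iter-just-prefix {x = just u} (Fin.toℕ≤pred[n] k) eq rewrite e = refl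

  Reach : Fin m → Fin m → Set
  Reach u v = ∃ λ s → iter g s (just u) ≡ just v

  ShortWalk : ℕ → Set
  ShortWalk s = ∀ {u v} → iter g s (just u) ≡ just v → ∃ λ t → t ℕ.< suc m × iter g t (just u) ≡ just v

  short-walk : ∀ s → ShortWalk s
  short-walk = <-rec ShortWalk shorten
    where
    shorten : ∀ s → (∀ {t} → t ℕ.< s → ShortWalk t) → ShortWalk s
    shorten s rec {u} eq with s ℕ.<? suc m
    ... | yes s≤m = s , s≤m , eq
    ... | no s≰m with walk-repeats (proj₂ (iter-just-prefix (ℕ.<⇒≤ (ℕ.≮⇒≥ s≰m)) eq))
    ... | i , j , i<j , j≤m , same = rec shorter (trans (iter-+-cong (just u) same (s ∸ j)) skip)
      where
      j≤s : j ℕ.≤ s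
      j≤s = ℕ.≤-trans j≤m (ℕ.<⇒≤ (ℕ.≮⇒≥ s≰m))
      shorter : s ∸ j + i ℕ.< s
      shorter = subst (s ∸ j + i ℕ.<_) (ℕ.m∸n+n≡m j≤s) (ℕ.+-monoʳ-< (s ∸ j) i<j)
      skip : iter g (s ∸ j + j) (just u) ≡ _
      skip = trans (cong (λ t → iter g t (just u)) (ℕ.m∸n+n≡m j≤s)) eq

  Reach⇒Reaches : ∀ {u v} → Reach u v → Reaches g u v
  Reach⇒Reaches (s , eq) with t , t≤m , eq′ ← short-walk s eq = lose (∈-upTo⁺ t≤m) eq′

  Reaches⇒Reach : ∀ {u v} → Reaches g u v → Reach u v
  Reaches⇒Reach = satisfied

  reach-refl : ∀ u → Reach u u
  reach-refl u = 0 , refl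

  reach-trans : ∀ {u v w} → Reach u v → Reach v w → Reach u w
  reach-trans (a , p) (b , q) = b + a , trans (iter-+ b a _) (trans (cong (iter g b) p) q)

  reach-edge : ∀ {u v} → lookup g u ≡ just v → Reach u v
  reach-edge e = 1 , e

  reach-cons : ∀ {u v w} → lookup g u ≡ just v → Reach v w → Reach u w
  reach-cons e = reach-trans (reach-edge e)

  reach-snoc : ∀ {u v w} → Reach u v → lookup g v ≡ just w → Reach u w
  reach-snoc r e = reach-trans r (reach-edge e)

  walk-first-step : ∀ s {x v} → iter g (suc s) (just x) ≡ just v →
                    ∃ λ w → lookup g x ≡ just w × iter g s (just w) ≡ just v
  walk-first-step s {x} eq with lookup g x in e
  ... | just w  = w , refl , trans (sym (trans (iter-sucʳ s (just x)) (cong (iter g s) e))) eq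
  ... | nothing with () ← trans (sym eq) (trans (iter-sucʳ s (just x)) (trans (cong (iter g s) e) (iter-nothing s)))

  reach-uncons : ∀ {u v} → Reach u v → u ≡ v ⊎ ∃ λ w → lookup g u ≡ just w × Reach w v
  reach-uncons (zero , eq) = inj₁ (just-injective eq)
  reach-uncons (suc s , eq) with w , e , eq′ ← walk-first-step s eq = inj₂ (w , e , s , eq′)

  reach-unsnoc : ∀ {u v} → Reach u v → u ≡ v ⊎ ∃ λ w → Reach u w × lookup g w ≡ just v
  reach-unsnoc (zero , eq) = inj₁ (just-injective eq)
  reach-unsnoc {u} (suc s , eq) with iter g s (just u) in e
  ... | just w = inj₂ (w , (s , e) , eq)

  closed-walk⇒cycle-edge : ∀ {v} s → iter g (suc s) (just v) ≡ just v → ∃ λ w → lookup g v ≡ just w × Reach w v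
  closed-walk⇒cycle-edge s closed with w , e , eq ← walk-first-step s closed = w , e , s , eq

  reach-along : ∀ {u a b s t} → s ℕ.≤ t → iter g s (just u) ≡ just a → iter g t (just u) ≡ just b → Reach a b
  reach-along {u} {s = s} {t} s≤t eq eq′ = t ∸ s , (begin
    iter g (t ∸ s) (just _)          ≡⟨ cong (iter g (t ∸ s)) eq ⟨
    iter g (t ∸ s) (iter g s (just u)) ≡⟨ iter-+ (t ∸ s) s (just u) ⟨
    iter g (t ∸ s + s) (just u)      ≡⟨ cong (λ r → iter g r (just u)) (ℕ.m∸n+n≡m s≤t) ⟩
    iter g t (just u)                ≡⟨ eq′ ⟩
    just _                           ∎)
    where open ≡-Reasoning

  reach-comparable : ∀ {u a b} → Reach u a → Reach u b → Reach a b ⊎ Reach b a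
  reach-comparable (s , eq) (t , eq′) with ℕ.≤-total s t
  ... | inj₁ s≤t = inj₁ (reach-along s≤t eq eq′)
  ... | inj₂ t≤s = inj₂ (reach-along t≤s eq′ eq)

  reach-ind-backward : ∀ {v} (P : Fin m → Set) → P v → (∀ {x w} → lookup g x ≡ just w → Reach w v → P w → P x) →
                       ∀ {x} → Reach x v → P x
  reach-ind-backward {v} P pv step′ (s , eq) = go s eq
    where
    go : ∀ s {x} → iter g s (just x) ≡ just v → P x
    go zero    refl = pv
    go (suc s) eq with _ , e , eq′ ← walk-first-step s eq = step′ e (s , eq′) (go s eq′)

  reach-ind-forward : ∀ {u} (P : Fin m → Set) → P u → (∀ {x w} → Reach u x → P x → lookup g x ≡ just w → P w) →
                      ∀ {y} → Reach u y → P y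
  reach-ind-forward {u} P pu step′ (s , eq) = go s eq
    where
    go : ∀ s {y} → iter g s (just u) ≡ just y → P y
    go zero    refl = pu
    go (suc s) eq with iter g s (just u) in e
    ... | just x = step′ (s , e) (go s e) eq

  cycle-free⇒falls-off : (∀ v s → iter g (suc s) (just v) ≢ just v) → ∀ u → iter g m (just u) ≡ nothing
  cycle-free⇒falls-off acyclic u with iter g m (just u) in e
  ... | nothing = refl
  ... | just v with walk-repeats e
  ... | i , j , i<j , j≤m , same with iter-just-prefix (ℕ.≤-trans (ℕ.<⇒≤ i<j) j≤m) e
  ... | w , eqi = ⊥-elim (acyclic w (j ∸ suc i) (begin
    iter g (suc (j ∸ suc i)) (just w)              ≡⟨ cong (iter g (suc (j ∸ suc i))) eqi ⟨
    iter g (suc (j ∸ suc i)) (iter g i (just u))   ≡⟨ iter-+ (suc (j ∸ suc i)) i (just u) ⟨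
    iter g (suc (j ∸ suc i) + i) (just u)          ≡⟨ cong (λ r → iter g r (just u)) (trans (sym (ℕ.+-suc _ i)) (ℕ.m∸n+n≡m i<j)) ⟩
    iter g j (just u)                              ≡⟨ trans (sym same) eqi ⟩
    just w                                         ∎))
    where open ≡-Reasoning

-- Least and greatest witnesses

leastWitness : ∀ {m} {P : Fin m → Set} → (∀ i → Dec (P i)) → Maybe (Fin m)
leastWitness {zero}  P? = nothing
leastWitness {suc m} P? with P? fzero
... | yes _ = just fzero
... | no _  = Maybe.map fsuc (leastWitness (P? ∘ fsuc))

greatestWitness : ∀ {m} {P : Fin m → Set} → (∀ i → Dec (P i)) → Maybe (Fin m)
greatestWitness {zero}  P? = nothing
greatestWitness {suc m} P? with greatestWitness (P? ∘ fsuc) | P? fzero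
... | just z  | _     = just (fsuc z)
... | nothing | yes _ = just fzero
... | nothing | no _  = nothing

leastWitness-just : ∀ {m} {P : Fin m → Set} (P? : ∀ i → Dec (P i)) {z} → leastWitness P? ≡ just z →
                    P z × (∀ i → i Fin.< z → ¬ P i)
leastWitness-just {suc m} P? eq with P? fzero
leastWitness-just {suc m} P? refl | yes p = p , λ _ ()
... | no ¬p with leastWitness (P? ∘ fsuc) in eq′
leastWitness-just {suc m} P? refl | no ¬p | just z with leastWitness-just (P? ∘ fsuc) eq′
... | pz , below = pz , λ { fzero _ → ¬p ; (fsuc i) (s≤s i<z) → below i i<z }

leastWitness-nothing : ∀ {m} {P : Fin m → Set} (P? : ∀ i → Dec (P i)) → leastWitness P? ≡ nothing → ∀ i → ¬ P i
leastWitness-nothing {suc m} P? eq i with P? fzero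
... | no ¬p with leastWitness (P? ∘ fsuc) in eq′
leastWitness-nothing {suc m} P? refl fzero    | no ¬p | nothing = ¬p
leastWitness-nothing {suc m} P? refl (fsuc i) | no ¬p | nothing = leastWitness-nothing (P? ∘ fsuc) eq′ i

greatestWitness-nothing : ∀ {m} {P : Fin m → Set} (P? : ∀ i → Dec (P i)) → greatestWitness P? ≡ nothing → ∀ i → ¬ P i
greatestWitness-nothing {suc m} P? eq i with greatestWitness (P? ∘ fsuc) in eq′ | P? fzero
greatestWitness-nothing {suc m} P? refl fzero    | nothing | no ¬p = ¬p
greatestWitness-nothing {suc m} P? refl (fsuc i) | nothing | no ¬p = greatestWitness-nothing (P? ∘ fsuc) eq′ i

greatestWitness-just : ∀ {m} {P : Fin m → Set} (P? : ∀ i → Dec (P i)) {z} → greatestWitness P? ≡ just z →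
                       P z × (∀ i → z Fin.< i → ¬ P i)
greatestWitness-just {suc m} P? eq with greatestWitness (P? ∘ fsuc) in eq′ | P? fzero
greatestWitness-just {suc m} P? refl | just z | _ with greatestWitness-just (P? ∘ fsuc) eq′
... | pz , above = pz , λ { (fsuc i) (s≤s z<i) → above i z<i }
greatestWitness-just {suc m} P? refl | nothing | yes p =
  p , λ { (fsuc i) _ → greatestWitness-nothing (P? ∘ fsuc) eq′ i }

module _ {m : ℕ} {P : Fin m → Set} (P? : ∀ i → Dec (P i)) where

  leastWitness-none : (∀ i → ¬ P i) → leastWitness P? ≡ nothing
  leastWitness-none none with leastWitness P? in eq
  ... | nothing = refl
  ... | just z  = ⊥-elim (none z (proj₁ (leastWitness-just P? eq)))

  leastWitness-≤ : ∀ {z} → P z → ∃ λ z′ → leastWitness P? ≡ just z′ × z′ Fin.≤ z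
  leastWitness-≤ {z} pz with leastWitness P? in eq
  ... | nothing = ⊥-elim (leastWitness-nothing P? eq z pz)
  ... | just z′ = z′ , refl , ℕ.≮⇒≥ (λ z<z′ → proj₂ (leastWitness-just P? eq) z z<z′ pz)

  leastWitness-unique : ∀ {z} → P z → (∀ i → i Fin.< z → ¬ P i) → leastWitness P? ≡ just z
  leastWitness-unique {z} pz below with leastWitness-≤ pz
  ... | z′ , eq , z′≤z with z′ Fin.≟ z
  ... | yes refl = eq
  ... | no z′≢z  = ⊥-elim (below z′ (Fin.≤∧≢⇒< z′≤z z′≢z) (proj₁ (leastWitness-just P? eq)))

  greatestWitness-≥ : ∀ {z} → P z → ∃ λ z′ → greatestWitness P? ≡ just z′ × z Fin.≤ z′
  greatestWitness-≥ {z} pz with greatestWitness P? in eq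
  ... | nothing = ⊥-elim (greatestWitness-nothing P? eq z pz)
  ... | just z′ = z′ , refl , ℕ.≮⇒≥ (λ z′<z → proj₂ (greatestWitness-just P? eq) z z′<z pz)

  greatestWitness-unique : ∀ {z} → P z → (∀ i → z Fin.< i → ¬ P i) → greatestWitness P? ≡ just z
  greatestWitness-unique {z} pz above with greatestWitness-≥ pz
  ... | z′ , eq , z≤z′ with z Fin.≟ z′
  ... | yes refl = eq
  ... | no z≢z′  = ⊥-elim (above z′ (Fin.≤∧≢⇒< z≤z′ z≢z′) (proj₁ (greatestWitness-just P? eq)))

least-witness : ∀ {Q : ℕ → Set} → (∀ t → Dec (Q t)) → ∀ {s} → Q s → ∃ λ t → Q t × (∀ t′ → t′ ℕ.< t → ¬ Q t′)
least-witness {Q} Q? {s} q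
  with z , found , _ ← leastWitness-≤ (Q? ∘ toℕ) {Fin.fromℕ s} (subst Q (sym (Fin.toℕ-fromℕ s)) q)
  with hit , below ← leastWitness-just (Q? ∘ toℕ) found = toℕ z , hit , earlier
  where
  earlier : ∀ t → t ℕ.< toℕ z → ¬ Q t
  earlier t t<z = below (Fin.fromℕ< t<1+s) (subst (ℕ._< toℕ z) (sym t′≡t) t<z) ∘ subst Q (sym t′≡t)
    where
    t<1+s = ℕ.<-trans t<z (Fin.toℕ<n z)
    t′≡t = Fin.toℕ-fromℕ< t<1+s

shortest-walk : ∀ {m} (g : Fun m) {u v} → Reach g u v →
                ∃ λ s → iter g s (just u) ≡ just v × (∀ t → t ℕ.< s → iter g t (just u) ≢ just v)
shortest-walk g {u} {v} (s , eq) = least-witness (λ t → iter g t (just u) ≟M just v) {s} eq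

-- Counting

indicator : ∀ {P : Set} → Dec P → ℕ
indicator (yes _) = 1
indicator (no _)  = 0

indicator-yes : ∀ {P : Set} (d : Dec P) → P → indicator d ≡ 1
indicator-yes (yes _) _ = refl
indicator-yes (no ¬p) p = ⊥-elim (¬p p)

indicator-no : ∀ {P : Set} (d : Dec P) → ¬ P → indicator d ≡ 0
indicator-no (yes p) ¬p = ⊥-elim (¬p p)
indicator-no (no _)  _  = refl

indicator-exclusive : ∀ {P Q : Set} (p? : Dec P) (q? : Dec Q) → P ⊎ Q → ¬ (P × Q) → indicator p? + indicator q? ≡ 1
indicator-exclusive (yes p) (yes q) _        excl = ⊥-elim (excl (p , q))
indicator-exclusive (yes _) (no _)  _        _    = refl
indicator-exclusive (no _)  (yes _) _        _    = refl
indicator-exclusive (no ¬p) (no _)  (inj₁ p) _    = ⊥-elim (¬p p)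
indicator-exclusive (no _)  (no ¬q) (inj₂ q) _    = ⊥-elim (¬q q)

count-∷ : ∀ {A : Set} {P : A → Set} (P? : ∀ x → Dec (P x)) x xs → count P? (x ∷ xs) ≡ indicator (P? x) + count P? xs
count-∷ P? x xs with P? x
... | yes _ = refl
... | no _  = refl

module _ {A : Set} where

  count-cong : ∀ {P Q : A → Set} (P? : ∀ x → Dec (P x)) (Q? : ∀ x → Dec (Q x)) xs →
               (∀ x → P x → Q x) → (∀ x → Q x → P x) → count P? xs ≡ count Q? xs
  count-cong P? Q? []       P⇒Q Q⇒P = refl
  count-cong P? Q? (x ∷ xs) P⇒Q Q⇒P
    rewrite count-∷ P? x xs | count-∷ Q? x xs | count-cong P? Q? xs P⇒Q Q⇒P
    with P? x | Q? x
  ... | yes _ | yes _ = refl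
  ... | no _  | no _  = refl
  ... | yes p | no ¬q = ⊥-elim (¬q (P⇒Q x p))
  ... | no ¬p | yes q = ⊥-elim (¬p (Q⇒P x q))

  count-map : ∀ {B : Set} {P : B → Set} (P? : ∀ x → Dec (P x)) (f : A → B) xs →
              count P? (map f xs) ≡ count (λ x → P? (f x)) xs
  count-map P? f []       = refl
  count-map P? f (x ∷ xs) rewrite count-∷ P? (f x) (map f xs) | count-∷ (λ x → P? (f x)) x xs
    = cong (indicator (P? (f x)) +_) (count-map P? f xs)

  count-none : ∀ {P : A → Set} (P? : ∀ x → Dec (P x)) xs → (∀ x → x ∈ xs → ¬ P x) → count P? xs ≡ 0
  count-none P? []       none = refl
  count-none P? (x ∷ xs) none rewrite count-∷ P? x xs
    | indicator-no (P? x) (none x (here refl)) = count-none P? xs (λ y y∈ → none y (there y∈))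

  count≡0⇒none : ∀ {P : A → Set} (P? : ∀ x → Dec (P x)) xs → count P? xs ≡ 0 → ∀ x → x ∈ xs → ¬ P x
  count≡0⇒none P? (y ∷ xs) c≡0 x x∈ px rewrite count-∷ P? y xs with P? y | x∈
  ... | yes _ | _         = ℕ.1+n≢0 c≡0
  ... | no ¬p | here refl = ¬p px
  ... | no _  | there x∈′ = count≡0⇒none P? xs c≡0 x x∈′ px

  count≡1⇒unique : ∀ {P : A → Set} (P? : ∀ x → Dec (P x)) xs → count P? xs ≡ 1 →
                   ∀ {x y} → x ∈ xs → y ∈ xs → P x → P y → x ≡ y
  count≡1⇒unique P? (z ∷ xs) c≡1 x∈ y∈ px py rewrite count-∷ P? z xs with P? z | x∈ | y∈
  ... | yes _ | here refl | here refl = refl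
  ... | yes _ | here refl | there y∈′ = ⊥-elim (count≡0⇒none P? xs (ℕ.suc-injective c≡1) _ y∈′ py)
  ... | yes _ | there x∈′ | _         = ⊥-elim (count≡0⇒none P? xs (ℕ.suc-injective c≡1) _ x∈′ px)
  ... | no ¬p | here refl | _         = ⊥-elim (¬p px)
  ... | no ¬p | there _   | here refl = ⊥-elim (¬p py)
  ... | no _  | there x∈′ | there y∈′ = count≡1⇒unique P? xs c≡1 x∈′ y∈′ px py

  count-only : ∀ {P : A → Set} (P? : ∀ x → Dec (P x)) xs → Unique xs → ∀ {a} → a ∈ xs →
               (∀ x → P x → x ≡ a) → count P? xs ≡ indicator (P? a)
  count-only P? (z ∷ xs) (z∉ ∷ _) (here refl) only rewrite count-∷ P? z xs =
    trans (cong (indicator (P? z) +_) (count-none P? xs (λ x x∈ px → All.lookup z∉ x∈ (sym (only x px)))))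
          (ℕ.+-identityʳ _)
  count-only P? (z ∷ xs) (z∉ ∷ u) (there a∈) only rewrite count-∷ P? z xs with P? z
  ... | yes pz = ⊥-elim (All.lookup z∉ a∈ (only z pz))
  ... | no _   = count-only P? xs u a∈ only

  count-atMostOne : ∀ {P : A → Set} (P? : ∀ x → Dec (P x)) xs → Unique xs → (∀ {x y} → P x → P y → x ≡ y) →
                    count P? xs ≡ indicator (any? P? xs)
  count-atMostOne P? xs u atMostOne with any? P? xs
  ... | no ¬any = count-none P? xs (λ x x∈ px → ¬any (lose x∈ px))
  ... | yes any with find any
  ... | x , x∈ , px = trans (count-only P? xs u x∈ (λ y py → atMostOne py px)) (indicator-yes (P? x) px)

  count-⊎ : ∀ {P Q : A → Set} (P? : ∀ x → Dec (P x)) (Q? : ∀ x → Dec (Q x)) xs → (∀ x → P x → ¬ Q x) →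
            count (λ x → P? x ⊎-dec Q? x) xs ≡ count P? xs + count Q? xs
  count-⊎ P? Q? []       disjoint = refl
  count-⊎ P? Q? (x ∷ xs) disjoint
    rewrite count-∷ (λ x → P? x ⊎-dec Q? x) x xs | count-∷ P? x xs | count-∷ Q? x xs | count-⊎ P? Q? xs disjoint
    with P? x | Q? x
  ... | yes p | yes q = ⊥-elim (disjoint x p q)
  ... | yes _ | no _  = refl
  ... | no _  | yes _ = sym (ℕ.+-suc _ _)
  ... | no _  | no _  = refl

  sum-indicator : ∀ {P : A → Set} (P? : ∀ x → Dec (P x)) xs → sum (map (λ x → indicator (P? x)) xs) ≡ count P? xs
  sum-indicator P? []       = refl
  sum-indicator P? (x ∷ xs) rewrite count-∷ P? x xs = cong (indicator (P? x) +_) (sum-indicator P? xs)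

  sum-map-+ : ∀ (f g : A → ℕ) xs → sum (map (λ x → f x + g x) xs) ≡ sum (map f xs) + sum (map g xs)
  sum-map-+ f g []       = refl
  sum-map-+ f g (x ∷ xs) rewrite sum-map-+ f g xs = interchange (f x) (g x) _ _

  sum-map-cong : ∀ {f g : A → ℕ} xs → (∀ x → f x ≡ g x) → sum (map f xs) ≡ sum (map g xs)
  sum-map-cong xs f≗g = cong sum (List.map-cong f≗g xs)

sum-count-comm : ∀ {A B : Set} {E : A → B → Set} (E? : ∀ i j → Dec (E i j)) xs ys →
                 sum (map (λ i → count (E? i) ys) xs) ≡ sum (map (λ j → count (λ i → E? i j) xs) ys)
sum-count-comm E? xs [] = sum-zeros xs
  where
  sum-zeros : ∀ {A : Set} (xs : List A) → sum (map (λ _ → 0) xs) ≡ 0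
  sum-zeros []       = refl
  sum-zeros (_ ∷ xs) = sum-zeros xs
sum-count-comm E? xs (y ∷ ys) = begin
  sum (map (λ i → count (E? i) (y ∷ ys)) xs)
    ≡⟨ sum-map-cong xs (λ i → count-∷ (E? i) y ys) ⟩
  sum (map (λ i → indicator (E? i y) + count (E? i) ys) xs)
    ≡⟨ sum-map-+ _ _ xs ⟩
  sum (map (λ i → indicator (E? i y)) xs) + sum (map (λ i → count (E? i) ys) xs)
    ≡⟨ cong₂ _+_ (sum-indicator (λ i → E? i y) xs) (sum-count-comm E? xs ys) ⟩
  count (λ i → E? i y) xs + sum (map (λ j → count (λ i → E? i j) xs) ys) ∎
  where open ≡-Reasoning

count-allFin-suc : ∀ {n} {P : Fin (suc n) → Set} (P? : ∀ x → Dec (P x)) →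
                   count P? (allFin (suc n)) ≡ indicator (P? fzero) + count (λ x → P? (fsuc x)) (allFin n)
count-allFin-suc {n} P? = begin
  count P? (allFin (suc n))                                 ≡⟨ cong (count P? ∘ (fzero ∷_)) (List.map-tabulate id fsuc) ⟨
  count P? (fzero ∷ map fsuc (allFin n))                    ≡⟨ count-∷ P? fzero _ ⟩
  indicator (P? fzero) + count P? (map fsuc (allFin n))     ≡⟨ cong (indicator (P? fzero) +_) (count-map P? fsuc (allFin n)) ⟩
  indicator (P? fzero) + count (λ x → P? (fsuc x)) (allFin n) ∎
  where open ≡-Reasoning

module _ {m : ℕ} (h : Fun m) {I : Fin m → Fin m → Set} (I? : ∀ i j → Dec (I i j)) where

  OutEdgeWith : Fin m → Set
  OutEdgeWith j = Any (λ i → lookup h j ≡ just i × I i j) (allFin m)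

  outEdgeWith? : ∀ j → Dec (OutEdgeWith j)
  outEdgeWith? j = any? (λ i → (lookup h j ≟M just i) ×-dec I? i j) (allFin m)

  outEdgeWith⇒nonRoot : ∀ {j} → OutEdgeWith j → lookup h j ≢ nothing
  outEdgeWith⇒nonRoot out root with _ , _ , e , _ ← find out with () ← trans (sym e) root

  sum-in-edges≡count-out-edges :
    sum (map (λ i → count (λ j → (lookup h j ≟M just i) ×-dec I? i j) (allFin m)) (allFin m)) ≡ count outEdgeWith? (allFin m)
  sum-in-edges≡count-out-edges = begin
    sum (map (λ i → count (λ j → (lookup h j ≟M just i) ×-dec I? i j) (allFin m)) (allFin m))
      ≡⟨ sum-count-comm (λ i j → (lookup h j ≟M just i) ×-dec I? i j) (allFin m) (allFin m) ⟩
    sum (map (λ j → count (λ i → (lookup h j ≟M just i) ×-dec I? i j) (allFin m)) (allFin m))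
      ≡⟨ sum-map-cong (allFin m) (λ j → count-atMostOne _ (allFin m) (Unique.allFin⁺ m) one-parent) ⟩
    sum (map (λ j → indicator (outEdgeWith? j)) (allFin m))
      ≡⟨ sum-indicator outEdgeWith? (allFin m) ⟩
    count outEdgeWith? (allFin m) ∎
    where
    open ≡-Reasoning
    one-parent : ∀ {j i i′} → lookup h j ≡ just i × I i j → lookup h j ≡ just i′ × I i′ j → i ≡ i′
    one-parent (e , _) (e′ , _) = just-injective (trans (sym e) e′)

radix-< : ∀ K {a b r r′} → a ℕ.< b → r ℕ.≤ K → 0 ℕ.< r′ → K ℕ.* a + r ℕ.< K ℕ.* b + r′
radix-< K {a} {b} {r} {r′} a<b r≤K 0<r′ = begin-strict
  K ℕ.* a + r   ≤⟨ ℕ.+-monoʳ-≤ (K ℕ.* a) r≤K ⟩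
  K ℕ.* a + K   ≡⟨ ℕ.+-comm (K ℕ.* a) K ⟩
  K + K ℕ.* a   ≡⟨ ℕ.*-suc K a ⟨
  K ℕ.* suc a   ≤⟨ ℕ.*-monoʳ-≤ K a<b ⟩
  K ℕ.* b       <⟨ ℕ.m<m+n (K ℕ.* b) 0<r′ ⟩
  K ℕ.* b + r′  ∎
  where open ℕ.≤-Reasoning

radix-≤ : ∀ K {a b r r′} → K ℕ.* a + r ℕ.≤ K ℕ.* b + r′ → 0 ℕ.< r → r′ ℕ.≤ K → a ℕ.≤ b
radix-≤ K le 0<r r′≤K = ℕ.≮⇒≥ (λ b<a → ℕ.<⇒≱ (radix-< K b<a r′≤K 0<r) le)

-- Rooted trees

module _ {m : ℕ} (f : Fun m) where

  sink-reachable : ∀ s {v} → iter f s (just v) ≡ nothing → ∃ λ r → lookup f r ≡ nothing × Reach f v r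
  sink-reachable (suc s) {v} e with nothing-or-just (iter f s (just v))
  ... | inj₁ e′       = sink-reachable s e′
  ... | inj₂ (r , e′) = r , trans (sym (cong (step f) e′)) e , s , e′

  sink-reach : ∀ {r v} → lookup f r ≡ nothing → Reach f r v → r ≡ v
  sink-reach fr rv with reach-uncons f rv
  ... | inj₁ r≡v         = r≡v
  ... | inj₂ (_ , e , _) with () ← trans (sym e) fr

  module _ (falls-off : ∀ u → iter f m (just u) ≡ nothing) where

    falls-off⇒acyclic : ∀ v s → iter f (suc s) (just v) ≢ just v
    falls-off⇒acyclic v s closed
      with () ← trans (sym (iter-periodic f closed m)) (iter-nothing-≤ f (ℕ.m≤m*n m (suc s)) (falls-off v))

    reach-antisym : ∀ {a b} → Reach f a b → Reach f b a → a ≡ b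
    reach-antisym (zero , e) _ = just-injective e
    reach-antisym {a} (suc s , e) (t , e′) = ⊥-elim (falls-off⇒acyclic a (t + s) (begin
      iter f (suc (t + s)) (just a)        ≡⟨ cong (λ r → iter f r (just a)) (ℕ.+-suc t s) ⟨
      iter f (t + suc s) (just a)          ≡⟨ iter-+ f t (suc s) (just a) ⟩
      iter f t (iter f (suc s) (just a))   ≡⟨ cong (iter f t) e ⟩
      iter f t (just _)                    ≡⟨ e′ ⟩
      just a                               ∎))
      where open ≡-Reasoning

    edge-irreversible : ∀ {a b} → lookup f a ≡ just b → ¬ Reach f b a
    edge-irreversible {a} e r with refl ← reach-antisym (reach-edge f e) r = falls-off⇒acyclic a 0 e

    reach-same-parent : ∀ {a b w} → lookup f a ≡ just w → lookup f b ≡ just w → Reach f a b → a ≡ b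
    reach-same-parent ea eb rab with reach-uncons f rab
    ... | inj₁ a≡b = a≡b
    ... | inj₂ (_ , ea′ , rwb) with refl ← trans (sym ea) ea′ = ⊥-elim (edge-irreversible eb rwb)

    parent-injective-along : ∀ {u a b w} → Reach f u a → Reach f u b → lookup f a ≡ just w → lookup f b ≡ just w → a ≡ b
    parent-injective-along ra rb ea eb with reach-comparable f ra rb
    ... | inj₁ rab = reach-same-parent ea eb rab
    ... | inj₂ rba = sym (reach-same-parent eb ea rba)

module _ {m : ℕ} (h : Fun m) where

  treeImproper⇒ : ∀ {i j} → TreeImproper h i j → ∃ λ d → Reach h d j × d Fin.< i
  treeImproper⇒ improper with d , _ , r , d<i ← find improper = d , Reaches⇒Reach h r , d<i

  treeImproper⇐ : ∀ {i j} → (∃ λ d → Reach h d j × d Fin.< i) → TreeImproper h i j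
  treeImproper⇐ (d , r , d<i) = lose (∈-allFin d) (Reach⇒Reaches h r , d<i)

  pfdImproper⇒ : ∀ {i j} → PFDImproper h i j → ∃ λ p → Reach h p j × p Fin.≤ i
  pfdImproper⇒ improper with p , _ , r , p≤i ← find improper = p , Reaches⇒Reach h r , p≤i

  pfdImproper⇐ : ∀ {i j} → (∃ λ p → Reach h p j × p Fin.≤ i) → PFDImproper h i j
  pfdImproper⇐ (p , r , p≤i) = lose (∈-allFin p) (Reach⇒Reaches h r , p≤i)

-- Cycles of a partial functional digraph

module Cycles {n : ℕ} (G : Fun n) where

  g : Fin n → Maybe (Fin n)
  g = lookup G

  sink-or-edge : ∀ x → g x ≡ nothing ⊎ ∃ λ y → g x ≡ just y
  sink-or-edge x = nothing-or-just (g x)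

  OnCycle : Fin n → Set
  OnCycle x = ∃ λ w → g x ≡ just w × Reach G w x

  onCycle? : ∀ x → Dec (OnCycle x)
  onCycle? x with g x
  ... | nothing = no λ { (_ , () , _) }
  ... | just w  = map′ (λ r → w , refl , Reaches⇒Reach G r)
                    (λ { (w′ , e′ , r) → Reach⇒Reaches G (subst (λ z → Reach G z x) (just-injective (sym e′)) r) })
                    (reaches? G w x)

  CycleMax : Fin n → Set
  CycleMax y = OnCycle y × (∀ z → Reach G y z → z Fin.≤ y)

  cycleMax? : ∀ y → Dec (CycleMax y)
  cycleMax? y = onCycle? y ×-dec map′
    (λ bound z r → All.lookup bound (∈-allFin z) (Reach⇒Reaches G r))
    (λ bound → All.tabulate (λ {z} _ r → bound z (Reaches⇒Reach G r)))
    (All.all? (λ z → reaches? G y z →-dec (z Fin.≤? y)) (allFin n))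

  onCycle-step : ∀ {x w} → OnCycle x → g x ≡ just w → OnCycle w
  onCycle-step (w′ , e′ , r) e with trans (sym e′) e
  ... | refl with reach-uncons G r
  ... | inj₁ refl         = w′ , e , reach-refl G w′
  ... | inj₂ (u , eu , ru) = u , eu , reach-snoc G ru e

  onCycle-reach : ∀ {x y} → OnCycle x → Reach G x y → OnCycle y
  onCycle-reach cx = reach-ind-forward G OnCycle cx (λ _ → onCycle-step)

  onCycle-reach-back : ∀ {x y} → OnCycle x → Reach G x y → Reach G y x
  onCycle-reach-back {y = y} cx r = reach-ind-backward G (λ u → OnCycle u → Reach G y u) (λ _ → reach-refl G y)
    (λ {u} e _ ih cu → reach-trans G (ih (onCycle-step cu e)) (back cu e)) r cx
    where
    back : ∀ {u w} → OnCycle u → g u ≡ just w → Reach G w u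
    back (_ , e′ , r′) e with trans (sym e′) e
    ... | refl = r′

  cycleMax-unique : ∀ {a b} → CycleMax a → CycleMax b → Reach G a b → a ≡ b
  cycleMax-unique (ca , below-a) (_ , below-b) r = Fin.≤-antisym (below-b _ (onCycle-reach-back ca r)) (below-a _ r)

  maxOfCycle : Fin n → Maybe (Fin n)
  maxOfCycle x = greatestWitness (reaches? G x)

  maxOfCycle-spec : ∀ {x} → OnCycle x → ∃ λ c → maxOfCycle x ≡ just c × CycleMax c × Reach G x c × Reach G c x
  maxOfCycle-spec {x} cx with greatestWitness-≥ (reaches? G x) (Reach⇒Reaches G (reach-refl G x))
  ... | c , found , _ with greatestWitness-just (reaches? G x) found
  ... | x⇝c , above = c , found , (onCycle-reach cx rxc , below) , rxc , onCycle-reach-back cx rxc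
    where
    rxc = Reaches⇒Reach G x⇝c
    below : ∀ z → Reach G c z → z Fin.≤ c
    below z r = ℕ.≮⇒≥ (λ c<z → above z c<z (Reach⇒Reaches G (reach-trans G rxc r)))

  maxOfCycle-unique : ∀ {x c} → OnCycle x → CycleMax c → Reach G x c → maxOfCycle x ≡ just c
  maxOfCycle-unique cx mc rxc with maxOfCycle-spec cx
  ... | c′ , found , mc′ , rxc′ , _ =
    trans found (cong just (cycleMax-unique mc′ mc (reach-trans G (onCycle-reach-back cx rxc′) rxc)))

  onCycle-pred : ∀ {p} → OnCycle p → ∃ λ x → OnCycle x × g x ≡ just p × Reach G p x
  onCycle-pred {p} cp@(w , e , r) with reach-unsnoc G r
  ... | inj₁ refl            = p , cp , e , reach-refl G p
  ... | inj₂ (x , rwx , gx) = x , onCycle-reach (onCycle-step cp e) rwx , gx , reach-cons G e rwx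

  onCycle-injective : ∀ {x x′ y} → OnCycle x → OnCycle x′ → g x ≡ just y → g x′ ≡ just y → x ≡ x′
  onCycle-injective {x} {x′} {y} (_ , gw , ryx) (_ , gw′ , ryx′) gx gx′
    with refl ← trans (sym gw) gx | refl ← trans (sym gw′) gx′
    with shortest-walk G ryx
  ... | s , walk , shortest with reach-ind-forward G Within (0 , z≤n , refl) extend ryx′
    where
    Within : Fin n → Set
    Within u = ∃ λ t → t ℕ.≤ s × iter G t (just y) ≡ just u
    extend : ∀ {u w} → Reach G y u → Within u → g u ≡ just w → Within w
    extend {u} _ (t , t≤s , et) gu with t ℕ.≟ s
    ... | yes refl with refl ← trans (sym et) walk = 0 , z≤n , trans (sym gx) gu
    ... | no t≢s = suc t , ℕ.≤∧≢⇒< t≤s t≢s , trans (cong (step G) et) gu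
  ... | t , t≤s , et with t ℕ.≟ s
  ... | yes refl = just-injective (trans (sym walk) et)
  ... | no t≢s   = ⊥-elim (shortest (s ∸ suc t) (ℕ.∸-monoʳ-< z<s t<s) shortcut)
    where
    t<s = ℕ.≤∧≢⇒< t≤s t≢s
    closed : iter G (suc t) (just y) ≡ iter G 0 (just y)
    closed = trans (cong (step G) et) gx′
    shortcut : iter G (s ∸ suc t) (just y) ≡ just x
    shortcut = begin
      iter G (s ∸ suc t) (just y)         ≡⟨ cong (λ r → iter G r (just y)) (ℕ.+-identityʳ (s ∸ suc t)) ⟨
      iter G (s ∸ suc t + 0) (just y)     ≡⟨ iter-+-cong G (just y) closed (s ∸ suc t) ⟨
      iter G (s ∸ suc t + suc t) (just y) ≡⟨ cong (λ r → iter G r (just y)) (ℕ.m∸n+n≡m t<s) ⟩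
      iter G s (just y)                   ≡⟨ walk ⟩
      just x                              ∎
      where open ≡-Reasoning

-- From partial functional digraphs to trees

module ToTree {n : ℕ} (G : Fun n) where
  open Cycles G

  firstCycleMax : Maybe (Fin n)
  firstCycleMax = leastWitness cycleMax?

  nextCycleMax : Fin n → Maybe (Fin n)
  nextCycleMax y = leastWitness (λ z → (y Fin.<? z) ×-dec cycleMax? z)

  parentOf : Fin n → Maybe (Fin n) → Maybe (Fin (suc n))
  parentOf x nothing = just fzero
  parentOf x (just y) with onCycle? x ×-dec cycleMax? y
  ... | yes _ = Maybe.map fsuc (nextCycleMax y)
  ... | no _  = just (fsuc y)

  parentOf-keep : ∀ {x y} → ¬ (OnCycle x × CycleMax y) → parentOf x (just y) ≡ just (fsuc y)
  parentOf-keep {x} {y} ¬redirect with onCycle? x ×-dec cycleMax? y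
  ... | yes redirect = ⊥-elim (¬redirect redirect)
  ... | no _         = refl

  parentOf-redirect : ∀ {x y} → OnCycle x × CycleMax y → parentOf x (just y) ≡ Maybe.map fsuc (nextCycleMax y)
  parentOf-redirect {x} {y} redirect with onCycle? x ×-dec cycleMax? y
  ... | yes _         = refl
  ... | no ¬redirect = ⊥-elim (¬redirect redirect)

  parent : Fin (suc n) → Maybe (Fin (suc n))
  parent fzero    = Maybe.map fsuc firstCycleMax
  parent (fsuc x) = parentOf x (g x)

  Ψ : Fun (suc n)
  Ψ = tabulate parent

  ψ : Fin (suc n) → Maybe (Fin (suc n))
  ψ = lookup Ψ

  ψ≡parent : ∀ v → ψ v ≡ parent v
  ψ≡parent = Vec.lookup∘tabulate parent

  ψ-new : ∀ {c} → firstCycleMax ≡ just c → ψ fzero ≡ just (fsuc c)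
  ψ-new first = trans (ψ≡parent fzero) (cong (Maybe.map fsuc) first)

  ψ-new-just : ∀ {w} → ψ fzero ≡ just w → ∃ λ c → w ≡ fsuc c × CycleMax c
  ψ-new-just e with firstCycleMax in first | trans (sym (ψ≡parent fzero)) e
  ... | just c | refl = c , refl , proj₁ (leastWitness-just cycleMax? first)

  ψ-sink : ∀ {x} → g x ≡ nothing → ψ (fsuc x) ≡ just fzero
  ψ-sink {x} gx = trans (ψ≡parent (fsuc x)) (cong (parentOf x) gx)

  ψ-keep : ∀ {x y} → g x ≡ just y → ¬ (OnCycle x × CycleMax y) → ψ (fsuc x) ≡ just (fsuc y)
  ψ-keep {x} gx ¬redirect = trans (ψ≡parent (fsuc x)) (trans (cong (parentOf x) gx) (parentOf-keep ¬redirect))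

  ψ-offCycle : ∀ {x y} → ¬ OnCycle x → g x ≡ just y → ψ (fsuc x) ≡ just (fsuc y)
  ψ-offCycle ¬cx gx = ψ-keep gx (¬cx ∘ proj₁)

  ψ-nonMax : ∀ {x y} → g x ≡ just y → ¬ CycleMax y → ψ (fsuc x) ≡ just (fsuc y)
  ψ-nonMax gx ¬my = ψ-keep gx (¬my ∘ proj₂)

  ψ-intoMax : ∀ {x y} → OnCycle x → g x ≡ just y → CycleMax y → ψ (fsuc x) ≡ Maybe.map fsuc (nextCycleMax y)
  ψ-intoMax {x} cx gx my = trans (ψ≡parent (fsuc x)) (trans (cong (parentOf x) gx) (parentOf-redirect (cx , my)))

  ψ-onCycle-just : ∀ {x w} → OnCycle x → ψ (fsuc x) ≡ just w → ∃ λ z → w ≡ fsuc z × OnCycle z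
  ψ-onCycle-just cx@(y , gx , _) e with cycleMax? y
  ... | no ¬my = y , just-injective (trans (sym e) (ψ-nonMax gx ¬my)) , onCycle-step cx gx
  ... | yes my with nextCycleMax y in next
  ... | just z  = z , just-injective (trans (sym e) (trans (ψ-intoMax cx gx my) (cong (Maybe.map fsuc) next))) ,
                  proj₁ (proj₂ (proj₁ (leastWitness-just _ next)))
  ... | nothing with () ← trans (sym e) (trans (ψ-intoMax cx gx my) (cong (Maybe.map fsuc) next))

  OnSpine : Fin (suc n) → Set
  OnSpine fzero    = ⊤
  OnSpine (fsuc x) = OnCycle x

  ψ-spine : ∀ {v w} → OnSpine v → ψ v ≡ just w → OnSpine w
  ψ-spine {fzero} _ e with ψ-new-just e
  ... | _ , refl , mc = proj₁ mc
  ψ-spine {fsuc x} cx e with ψ-onCycle-just cx e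
  ... | _ , refl , cz = cz

  spine-closed : ∀ {v w} → OnSpine v → Reach Ψ v w → OnSpine w
  spine-closed sv = reach-ind-forward Ψ OnSpine sv (λ _ → ψ-spine)

  ψ-offCycle⁻¹ : ∀ {x y} → ¬ OnCycle x → ψ (fsuc x) ≡ just (fsuc y) → g x ≡ just y
  ψ-offCycle⁻¹ {x} ¬cx e with sink-or-edge x
  ... | inj₁ gx with () ← trans (sym e) (ψ-sink gx)
  ... | inj₂ (_ , gx) with refl ← trans (sym e) (ψ-offCycle ¬cx gx) = gx

  ψ-into-offCycle : ∀ {v y} → ψ v ≡ just (fsuc y) → ¬ OnCycle y → ∃ λ x → v ≡ fsuc x × ¬ OnCycle x × g x ≡ just y
  ψ-into-offCycle {fzero} e ¬cy with ψ-new-just e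
  ... | _ , refl , my = ⊥-elim (¬cy (proj₁ my))
  ψ-into-offCycle {fsuc x} e ¬cy with onCycle? x
  ... | yes cx with ψ-onCycle-just cx e
  ...   | _ , refl , cy = ⊥-elim (¬cy cy)
  ψ-into-offCycle {fsuc x} e ¬cy | no ¬cx = x , refl , ¬cx , ψ-offCycle⁻¹ ¬cx e

  reach-g⇒reach-ψ : ∀ {x y} → Reach G x y → ¬ OnCycle y → Reach Ψ (fsuc x) (fsuc y)
  reach-g⇒reach-ψ {y = y} r ¬cy = reach-ind-backward G (λ u → Reach Ψ (fsuc u) (fsuc y)) (reach-refl Ψ (fsuc y)) extend r
    where
    extend : ∀ {u w} → g u ≡ just w → Reach G w y → Reach Ψ (fsuc w) (fsuc y) → Reach Ψ (fsuc u) (fsuc y)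
    extend gu rwy r′ = reach-cons Ψ (ψ-offCycle (λ cu → ¬cy (onCycle-reach cu (reach-cons G gu rwy))) gu) r′

  reach-ψ⇒reach-g : ∀ {x y} → Reach Ψ (fsuc x) (fsuc y) → ¬ OnCycle y → Reach G x y
  reach-ψ⇒reach-g {x} {y} r ¬cy with reach-ind-backward Ψ Below (y , refl , ¬cy , reach-refl G y) extend r
    where
    Below : Fin (suc n) → Set
    Below v = ∃ λ u → v ≡ fsuc u × ¬ OnCycle u × Reach G u y
    extend : ∀ {v w} → ψ v ≡ just w → Reach Ψ w (fsuc y) → Below w → Below v
    extend {v} e _ (u , refl , ¬cu , ruy) with ψ-into-offCycle {v} e ¬cu
    ... | x′ , refl , ¬cx′ , gx′ = x′ , refl , ¬cx′ , reach-cons G gx′ ruy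
  ... | _ , refl , _ , rxy = rxy

  reach-around-cycle : ∀ {c x} → CycleMax c → Reach G c x → Reach Ψ (fsuc c) (fsuc x)
  reach-around-cycle {c} mc = reach-ind-forward G (λ u → Reach Ψ (fsuc c) (fsuc u)) (reach-refl Ψ (fsuc c)) extend
    where
    extend : ∀ {u w} → Reach G c u → Reach Ψ (fsuc c) (fsuc u) → g u ≡ just w → Reach Ψ (fsuc c) (fsuc w)
    extend {w = w} rcu r gu with cycleMax? w
    ... | yes mw with refl ← cycleMax-unique mc mw (reach-snoc G rcu gu) = reach-refl Ψ (fsuc c)
    ... | no ¬mw = reach-snoc Ψ r (ψ-nonMax gu ¬mw)

  reach-cycleMax : ∀ {c} → CycleMax c → Reach Ψ fzero (fsuc c)
  reach-cycleMax {c} = All.wfRec Fin.<-wellFounded _ (λ c → CycleMax c → Reach Ψ fzero (fsuc c)) viaPrevious c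
    where
    viaPrevious : ∀ c → (∀ {p} → p Fin.< c → CycleMax p → Reach Ψ fzero (fsuc p)) → CycleMax c → Reach Ψ fzero (fsuc c)
    viaPrevious c rec mc with leastWitness-≤ cycleMax? mc
    ... | c₀ , first , c₀≤c with c₀ Fin.≟ c
    ... | yes refl = reach-edge Ψ (ψ-new first)
    ... | no c₀≢c with greatestWitness-≥ (λ z → (z Fin.<? c) ×-dec cycleMax? z)
                         (Fin.≤∧≢⇒< c₀≤c c₀≢c , proj₁ (leastWitness-just cycleMax? first))
    ... | p , previous , _ with greatestWitness-just _ previous
    ... | (p<c , mp) , above with onCycle-pred (proj₁ mp)
    ... | x , cx , gx , rpx =
      reach-snoc Ψ (reach-trans Ψ (rec p<c mp) (reach-around-cycle mp rpx))
        (trans (ψ-intoMax cx gx mp) (cong (Maybe.map fsuc) next))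
      where
      next : nextCycleMax p ≡ just c
      next = leastWitness-unique _ (p<c , mc) (λ z z<c (p<z , mz) → above z p<z (z<c , mz))

  reach-onCycle : ∀ {x} → OnCycle x → Reach Ψ fzero (fsuc x)
  reach-onCycle cx with maxOfCycle-spec cx
  ... | c , _ , mc , _ , rcx = reach-trans Ψ (reach-cycleMax mc) (reach-around-cycle mc rcx)

  opaque
    hits? : ∀ x c (s : Fin (suc n)) → Dec (iter G (toℕ s) (just x) ≡ just c)
    hits? x c s = iter G (toℕ s) (just x) ≟M just c

    distance : Fin n → Fin n → ℕ
    distance x c = Maybe.maybe toℕ 0 (leastWitness (hits? x c))

    distance≤n : ∀ x c → distance x c ℕ.≤ n
    distance≤n x c with leastWitness (hits? x c)
    ... | just d  = Fin.toℕ≤pred[n] d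
    ... | nothing = z≤n

    distance-≤ : ∀ {x c k} (k<1+n : k ℕ.< suc n) → iter G k (just x) ≡ just c → distance x c ℕ.≤ k
    distance-≤ {x} {c} {k} k<1+n hit
      with d , found , d≤k ← leastWitness-≤ (hits? x c) {Fin.fromℕ< k<1+n}
                               (subst (λ t → iter G t (just x) ≡ just c) (sym (Fin.toℕ-fromℕ< k<1+n)) hit)
      rewrite found = subst (toℕ d ℕ.≤_) (Fin.toℕ-fromℕ< k<1+n) d≤k

    distance-hits : ∀ {x c} → Reach G x c → iter G (distance x c) (just x) ≡ just c
    distance-hits {x} {c} r with leastWitness (hits? x c) in found
    ... | just d  = proj₁ (leastWitness-just (hits? x c) found)
    ... | nothing with k , k<1+n , hit ← short-walk G (proj₁ r) (proj₂ r) =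
      ⊥-elim (leastWitness-nothing (hits? x c) found (Fin.fromℕ< k<1+n)
               (subst (λ t → iter G t (just x) ≡ just c) (sym (Fin.toℕ-fromℕ< k<1+n)) hit))

  distance-step : ∀ {x y c} → g x ≡ just y → x ≢ c → Reach G x c → distance y c ℕ.< distance x c
  distance-step {x} {y} {c} gx x≢c r with distance x c | distance-hits r | distance≤n x c
  ... | zero  | hit | _    = ⊥-elim (x≢c (just-injective hit))
  ... | suc j | hit | d≤n = s≤s (distance-≤ (ℕ.<-trans (ℕ.n<1+n j) (s≤s d≤n)) hit′)
    where
    hit′ : iter G j (just y) ≡ just c
    hit′ = trans (cong (iter G j) (sym gx)) (trans (sym (iter-sucʳ G j (just x))) hit)

  -- Ψ runs through the cycles in increasing order of their maxima, entering each at its maximum c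
  -- and then approaching c along the cycle, so the potential (c, then the progress towards c,
  -- written in radix K) strictly increases along the spine.
  K : ℕ
  K = suc (suc n)

  offset : Fin n → Fin n → ℕ
  offset x c with x Fin.≟ c
  ... | yes _ = 1
  ... | no _  = K ∸ distance x c

  offset-self : ∀ c → offset c c ≡ 1
  offset-self c with c Fin.≟ c
  ... | yes _  = refl
  ... | no c≢c = ⊥-elim (c≢c refl)

  offset-other : ∀ {x c} → x ≢ c → offset x c ≡ K ∸ distance x c
  offset-other {x} {c} x≢c with x Fin.≟ c
  ... | yes x≡c = ⊥-elim (x≢c x≡c)
  ... | no _    = refl

  1<K∸distance : ∀ x c → 1 ℕ.< K ∸ distance x c
  1<K∸distance x c rewrite ℕ.+-∸-assoc 2 (distance≤n x c) = s≤s (s≤s z≤n)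

  0<offset : ∀ x c → 0 ℕ.< offset x c
  0<offset x c with x Fin.≟ c
  ... | yes refl = s≤s z≤n
  ... | no _     = ℕ.<-trans (s≤s z≤n) (1<K∸distance x c)

  offset≤K : ∀ x c → offset x c ℕ.≤ K
  offset≤K x c with x Fin.≟ c
  ... | yes _ = s≤s z≤n
  ... | no _  = ℕ.m∸n≤m K (distance x c)

  offset-step : ∀ {x y c} → g x ≡ just y → y ≢ c → Reach G x c → offset x c ℕ.< offset y c
  offset-step {x} {y} {c} gx y≢c r with x Fin.≟ c
  ... | yes refl rewrite offset-other y≢c = 1<K∸distance y c
  ... | no x≢c rewrite offset-other y≢c =
    ℕ.∸-monoʳ-< (distance-step gx x≢c r) (ℕ.m≤n⇒m≤1+n (ℕ.m≤n⇒m≤1+n (distance≤n x c)))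

  potentialVia : Maybe (Fin n) → Fin n → ℕ
  potentialVia nothing  x = 0
  potentialVia (just c) x = K ℕ.* toℕ c + offset x c

  potential : Fin (suc n) → ℕ
  potential fzero    = 0
  potential (fsuc x) = potentialVia (maxOfCycle x) x

  potential-onCycle : ∀ {x c} → maxOfCycle x ≡ just c → potential (fsuc x) ≡ K ℕ.* toℕ c + offset x c
  potential-onCycle {x} found = cong (λ m → potentialVia m x) found

  potential-cycleMax : ∀ {c} → CycleMax c → potential (fsuc c) ≡ K ℕ.* toℕ c + 1
  potential-cycleMax {c} mc =
    trans (potential-onCycle (maxOfCycle-unique (proj₁ mc) mc (reach-refl G c))) (cong (K ℕ.* toℕ c +_) (offset-self c))

  potential-step : ∀ {v w} → OnSpine v → ψ v ≡ just w → potential v ℕ.< potential w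
  potential-step {fzero} _ e with ψ-new-just e
  ... | c , refl , mc = subst (0 ℕ.<_) (sym (potential-cycleMax mc)) (ℕ.m≤n+m 1 (K ℕ.* toℕ c))
  potential-step {fsuc x} cx@(y , gx , _) e with maxOfCycle-spec cx
  ... | c , found , mc , rxc , _ with reach-trans G (onCycle-reach-back cx (reach-edge G gx)) rxc | cycleMax? y
  ... | ryc | no ¬my with refl ← trans (sym e) (ψ-nonMax gx ¬my) =
    subst₂ ℕ._<_ (sym (potential-onCycle found)) (sym (potential-onCycle (maxOfCycle-unique (onCycle-step cx gx) mc ryc)))
      (ℕ.+-monoʳ-< (K ℕ.* toℕ c) (offset-step gx (λ { refl → ¬my mc }) rxc))
  ... | ryc | yes my with refl ← cycleMax-unique my mc ryc | nothing-or-just (nextCycleMax y)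
  ... | inj₁ none with () ← trans (sym e) (trans (ψ-intoMax cx gx my) (cong (Maybe.map fsuc) none))
  ... | inj₂ (z , next) with refl ← trans (sym e) (trans (ψ-intoMax cx gx my) (cong (Maybe.map fsuc) next))
                           | (y<z , mz) , _ ← leastWitness-just _ next =
    subst₂ ℕ._<_ (sym (potential-onCycle found)) (sym (potential-cycleMax mz)) (radix-< K y<z (offset≤K x y) (s≤s z≤n))

  potential-walk : ∀ {v} → OnSpine v → ∀ t {u} → iter Ψ (suc t) (just v) ≡ just u → potential v ℕ.< potential u
  potential-walk sv zero    e = potential-step sv e
  potential-walk {v} sv (suc t) e with iter Ψ (suc t) (just v) in e′
  ... | just u′ = ℕ.<-trans (potential-walk sv t e′) (potential-step (spine-closed sv (suc t , e′)) e)

  potential-reach : ∀ {v u} → OnSpine v → Reach Ψ v u → potential v ℕ.≤ potential u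
  potential-reach sv (zero  , refl) = ℕ.≤-refl
  potential-reach sv (suc t , e)    = ℕ.<⇒≤ (potential-walk sv t e)

  Ψ-acyclic : ∀ v s → iter Ψ (suc s) (just v) ≢ just v
  Ψ-acyclic fzero    s e = ℕ.<-irrefl refl (potential-walk tt s e)
  Ψ-acyclic (fsuc x) s e with onCycle? x
  ... | yes cx = ℕ.<-irrefl refl (potential-walk cx s e)
  ... | no ¬cx with closed-walk⇒cycle-edge Ψ s e
  ... | fzero  , _  , rwx = ¬cx (spine-closed tt rwx)
  ... | fsuc y , ψx , rwx = ¬cx (y , ψ-offCycle⁻¹ ¬cx ψx , reach-ψ⇒reach-g rwx ¬cx)

  LastCycleMax : Fin n → Set
  LastCycleMax y = CycleMax y × (∀ z → CycleMax z → z Fin.≤ y)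

  ψ-root : ∀ {v} → ψ v ≡ nothing →
           (v ≡ fzero × (∀ x → ¬ OnCycle x)) ⊎ (∃₂ λ x y → v ≡ fsuc x × OnCycle x × g x ≡ just y × LastCycleMax y)
  ψ-root {fzero} e with firstCycleMax in first
  ... | just _ with () ← e
  ... | nothing =
    inj₁ (refl , λ x cx → leastWitness-nothing cycleMax? first _ (proj₁ (proj₂ (proj₂ (maxOfCycle-spec cx)))))
  ψ-root {fsuc x} e with onCycle? x | sink-or-edge x
  ... | no ¬cx | inj₁ gx       with () ← trans (sym e) (ψ-sink gx)
  ... | no ¬cx | inj₂ (_ , gx) with () ← trans (sym e) (ψ-offCycle ¬cx gx)
  ... | yes cx@(y , gx , _) | _ with cycleMax? y
  ... | no ¬my with () ← trans (sym e) (ψ-nonMax gx ¬my)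
  ... | yes my with nextCycleMax y in next
  ... | just _ with () ← trans (sym e) (trans (ψ-intoMax cx gx my) (cong (Maybe.map fsuc) next))
  ... | nothing = inj₂ (x , y , refl , cx , gx , my , λ z mz → ℕ.≮⇒≥ (λ y<z → leastWitness-nothing _ next z (y<z , mz)))

  root-unique : ∀ {v v′} → ψ v ≡ nothing → ψ v′ ≡ nothing → v ≡ v′
  root-unique {v} {v′} e e′ with ψ-root {v} e | ψ-root {v′} e′
  ... | inj₁ (refl , _)     | inj₁ (refl , _)     = refl
  ... | inj₁ (_ , acyclic)  | inj₂ (x , _ , _ , cx , _) = ⊥-elim (acyclic x cx)
  ... | inj₂ (x , _ , _ , cx , _) | inj₁ (_ , acyclic) = ⊥-elim (acyclic x cx)
  ... | inj₂ (x , y , refl , cx , gx , my , last) | inj₂ (x′ , y′ , refl , cx′ , gx′ , my′ , last′)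
    with refl ← Fin.≤-antisym (last′ y my) (last y′ my′) = cong fsuc (onCycle-injective cx cx′ gx gx′)

  root-exists : ∃ λ r → ψ r ≡ nothing
  root-exists with greatestWitness cycleMax? in greatest
  ... | nothing = fzero , trans (ψ≡parent fzero)
                    (cong (Maybe.map fsuc) (leastWitness-none cycleMax? (greatestWitness-nothing cycleMax? greatest)))
  ... | just c with greatestWitness-just cycleMax? greatest
  ... | mc , above with onCycle-pred (proj₁ mc)
  ... | x , cx , gx , _ = fsuc x , trans (ψ-intoMax cx gx mc)
                            (cong (Maybe.map fsuc) (leastWitness-none _ (λ z (c<z , mz) → above z c<z mz)))

  Ψ-rootedTree : IsRootedTree Ψ
  Ψ-rootedTree = one-root , All.tabulate (λ {u} _ → cycle-free⇒falls-off Ψ Ψ-acyclic u)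
    where
    one-root : nNothing Ψ ≡ 1
    one-root with r , ψr ← root-exists =
      trans (count-only (λ v → ψ v ≟M nothing) (allFin (suc n)) (Unique.allFin⁺ (suc n)) (∈-allFin r)
                        (λ v ψv → root-unique ψv ψr))
            (indicator-yes (ψ r ≟M nothing) ψr)

  improper-offCycle⇒ : ∀ {i j} → ¬ OnCycle j → g j ≡ just i → PFDImproper G i j → TreeImproper Ψ (fsuc i) (fsuc j)
  improper-offCycle⇒ {i} {j} ¬cj gj improper with p , rpj , p≤i ← pfdImproper⇒ G improper =
    treeImproper⇐ Ψ (fsuc p , reach-g⇒reach-ψ rpj ¬cj , s≤s (Fin.≤∧≢⇒< p≤i p≢i))
    where
    p≢i : p ≢ i
    p≢i refl = ¬cj (i , gj , rpj)

  improper-offCycle⇐ : ∀ {i j} → ¬ OnCycle j → TreeImproper Ψ (fsuc i) (fsuc j) → PFDImproper G i j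
  improper-offCycle⇐ ¬cj improper with treeImproper⇒ Ψ improper
  ... | fzero  , r , _         = ⊥-elim (¬cj (spine-closed tt r))
  ... | fsuc p , r , s≤s p<i = pfdImproper⇐ G (p , reach-ψ⇒reach-g r ¬cj , ℕ.<⇒≤ p<i)

  cycle-edge-improper : ∀ {i j} → OnCycle j → g j ≡ just i → PFDImproper G i j
  cycle-edge-improper (w , gw , r) gj with refl ← trans (sym gw) gj = pfdImproper⇐ G (w , r , Fin.≤-refl)

  spine-edge-improper : ∀ {v w} → OnSpine v → ψ v ≡ just w → TreeImproper Ψ w v
  spine-edge-improper {fzero} _ e with ψ-new-just e
  ... | _ , refl , _ = treeImproper⇐ Ψ (fzero , reach-refl Ψ fzero , s≤s z≤n)
  spine-edge-improper {fsuc j} cj e with ψ-onCycle-just cj e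
  ... | _ , refl , _ = treeImproper⇐ Ψ (fzero , reach-onCycle cj , s≤s z≤n)

  pdegT-Ψ : ∀ i → pdegT Ψ (fsuc i) ≡ pindegG G i
  pdegT-Ψ i = begin
    pdegT Ψ (fsuc i)
      ≡⟨ count-allFin-suc ProperChild? ⟩
    indicator (ProperChild? fzero) + count (ProperChild? ∘ fsuc) (allFin n)
      ≡⟨ cong (_+ count (ProperChild? ∘ fsuc) (allFin n)) (indicator-no (ProperChild? fzero) new-not-proper) ⟩
    count (ProperChild? ∘ fsuc) (allFin n)
      ≡⟨ count-cong (ProperChild? ∘ fsuc) ProperInEdge? (allFin n) to from ⟩
    pindegG G i ∎
    where
    open ≡-Reasoning
    ProperChild? = λ v → (ψ v ≟M just (fsuc i)) ×-dec ¬? (treeImproper? Ψ (fsuc i) v)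
    ProperInEdge? = λ j → (g j ≟M just i) ×-dec ¬? (pfdImproper? G i j)
    new-not-proper : ¬ (ψ fzero ≡ just (fsuc i) × ¬ TreeImproper Ψ (fsuc i) fzero)
    new-not-proper (e , proper) = proper (spine-edge-improper tt e)
    to : ∀ j → ψ (fsuc j) ≡ just (fsuc i) × ¬ TreeImproper Ψ (fsuc i) (fsuc j) → g j ≡ just i × ¬ PFDImproper G i j
    to j (e , proper) with onCycle? j
    ... | yes cj = ⊥-elim (proper (spine-edge-improper cj e))
    ... | no ¬cj with gj ← ψ-offCycle⁻¹ ¬cj e = gj , proper ∘ improper-offCycle⇒ ¬cj gj
    from : ∀ j → g j ≡ just i × ¬ PFDImproper G i j → ψ (fsuc j) ≡ just (fsuc i) × ¬ TreeImproper Ψ (fsuc i) (fsuc j)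
    from j (gj , proper) with onCycle? j
    ... | yes cj = ⊥-elim (proper (cycle-edge-improper cj gj))
    ... | no ¬cj = ψ-offCycle ¬cj gj , proper ∘ improper-offCycle⇐ ¬cj

  nChildren-new : nChildren Ψ fzero ≡ nNothing G
  nChildren-new = begin
    nChildren Ψ fzero
      ≡⟨ count-allFin-suc Child? ⟩
    indicator (Child? fzero) + count (Child? ∘ fsuc) (allFin n)
      ≡⟨ cong (_+ count (Child? ∘ fsuc) (allFin n)) (indicator-no (Child? fzero) not-own-child) ⟩
    count (Child? ∘ fsuc) (allFin n)
      ≡⟨ count-cong (Child? ∘ fsuc) (λ j → g j ≟M nothing) (allFin n) child⇒sink (λ _ → ψ-sink) ⟩
    nNothing G ∎
    where
    open ≡-Reasoning
    Child? = λ v → ψ v ≟M just fzero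
    not-own-child : ψ fzero ≢ just fzero
    not-own-child e with ψ-new-just e
    ... | _ , () , _
    child⇒sink : ∀ j → ψ (fsuc j) ≡ just fzero → g j ≡ nothing
    child⇒sink j e with onCycle? j
    ... | yes cj with ψ-onCycle-just cj e
    ...   | _ , () , _
    child⇒sink j e | no ¬cj with sink-or-edge j
    ... | inj₁ gj       = gj
    ... | inj₂ (_ , gj) with () ← trans (sym e) (ψ-offCycle ¬cj gj)

  TreeImproperOut : Fin (suc n) → Set
  TreeImproperOut = OutEdgeWith Ψ (treeImproper? Ψ)

  PFDImproperOut : Fin n → Set
  PFDImproperOut = OutEdgeWith G (pfdImproper? G)

  improperOut⇒ : ∀ j → PFDImproperOut j → TreeImproperOut (fsuc j) ⊎ ψ (fsuc j) ≡ nothing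
  improperOut⇒ j out with i , _ , gj , improper ← find out | onCycle? j
  ... | no ¬cj = inj₁ (lose (∈-allFin (fsuc i)) (ψ-offCycle ¬cj gj , improper-offCycle⇒ ¬cj gj improper))
  ... | yes cj with nothing-or-just (ψ (fsuc j))
  ... | inj₁ root     = inj₂ root
  ... | inj₂ (w , e) = inj₁ (lose (∈-allFin w) (e , spine-edge-improper cj e))

  improperOut⇐ : ∀ j → TreeImproperOut (fsuc j) ⊎ ψ (fsuc j) ≡ nothing → PFDImproperOut j
  improperOut⇐ j (inj₁ out) with w , _ , e , improper ← find out | onCycle? j
  ... | yes cj@(y , gj , _) = lose (∈-allFin y) (gj , cycle-edge-improper cj gj)
  ... | no ¬cj with sink-or-edge j
  ... | inj₂ (y , gj) with refl ← trans (sym e) (ψ-offCycle ¬cj gj) =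
    lose (∈-allFin y) (gj , improper-offCycle⇐ ¬cj improper)
  ... | inj₁ gj with refl ← trans (sym e) (ψ-sink gj) with treeImproper⇒ Ψ improper
  ...   | _ , _ , ()
  improperOut⇐ j (inj₂ root) with ψ-root {fsuc j} root
  ... | inj₂ (x , y , refl , cx , gx , _) = lose (∈-allFin y) (gx , cycle-edge-improper cx gx)

  impropeT-Ψ : impropeT Ψ ≡ impropeG G
  impropeT-Ψ = begin
    impropeT Ψ                                ≡⟨ sum-in-edges≡count-out-edges Ψ (treeImproper? Ψ) ⟩
    count T? (allFin (suc n))                 ≡⟨ count-allFin-suc T? ⟩
    indicator (T? fzero) + X                  ≡⟨ cong (_+ X) new-improper≡later-roots ⟩
    Y + X                                     ≡⟨ ℕ.+-comm Y X ⟩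
    X + Y                                     ≡⟨ count-⊎ (T? ∘ fsuc) (root? ∘ fsuc) (allFin n) improper⇒nonRoot ⟨
    count (λ j → T? (fsuc j) ⊎-dec root? (fsuc j)) (allFin n)
                                              ≡⟨ count-cong P? _ (allFin n) improperOut⇒ improperOut⇐ ⟨
    count P? (allFin n)                       ≡⟨ sum-in-edges≡count-out-edges G (pfdImproper? G) ⟨
    impropeG G                                ∎
    where
    open ≡-Reasoning
    T? = outEdgeWith? Ψ (treeImproper? Ψ)
    improper⇒nonRoot : ∀ j → TreeImproperOut (fsuc j) → ψ (fsuc j) ≢ nothing
    improper⇒nonRoot _ = outEdgeWith⇒nonRoot Ψ (treeImproper? Ψ)
    P? = outEdgeWith? G (pfdImproper? G)
    root? = λ v → ψ v ≟M nothing
    X = count (T? ∘ fsuc) (allFin n)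
    Y = count (root? ∘ fsuc) (allFin n)
    new-improper-or-root : indicator (T? fzero) + indicator (root? fzero) ≡ 1
    new-improper-or-root = indicator-exclusive (T? fzero) (root? fzero) improper-or-root
      (λ (out , root) → outEdgeWith⇒nonRoot Ψ (treeImproper? Ψ) out root)
      where
      improper-or-root : TreeImproperOut fzero ⊎ ψ fzero ≡ nothing
      improper-or-root with nothing-or-just (ψ fzero)
      ... | inj₁ root    = inj₂ root
      ... | inj₂ (w , e) = inj₁ (lose (∈-allFin w) (e , spine-edge-improper tt e))
    new-improper≡later-roots : indicator (T? fzero) ≡ Y
    new-improper≡later-roots = ℕ.+-cancelʳ-≡ (indicator (root? fzero)) _ _ (begin
      indicator (T? fzero) + indicator (root? fzero) ≡⟨ new-improper-or-root ⟩
      1                                              ≡⟨ proj₁ Ψ-rootedTree ⟨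
      nNothing Ψ                                     ≡⟨ count-allFin-suc root? ⟩
      indicator (root? fzero) + Y                    ≡⟨ ℕ.+-comm _ Y ⟩
      Y + indicator (root? fzero)                    ∎)

-- From trees to partial functional digraphs

module ToPFD {n : ℕ} (f : Fun (suc n)) where

  t : Fin (suc n) → Maybe (Fin (suc n))
  t = lookup f

  OnPath : Fin n → Set
  OnPath y = Reach f fzero (fsuc y)

  PathBelow : Fin n → Fin n → Set
  PathBelow x z = OnPath z × Reach f (fsuc z) (fsuc x)

  onPath? : ∀ y → Dec (OnPath y)
  onPath? y = map′ (Reaches⇒Reach f) (Reach⇒Reaches f) (reaches? f fzero (fsuc y))

  opaque
    pathBelow? : ∀ x z → Dec (PathBelow x z)
    pathBelow? x z = map′
      (λ (r , r′) → Reaches⇒Reach f r , Reaches⇒Reach f r′) (λ (r , r′) → Reach⇒Reaches f r , Reach⇒Reaches f r′)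
      (reaches? f fzero (fsuc z) ×-dec reaches? f (fsuc z) (fsuc x))

  pathMax : Fin n → Maybe (Fin n)
  pathMax x = greatestWitness (pathBelow? x)

  -- The clauses for (nothing , nothing) and (just M , just fzero) are junk: in a rooted tree a
  -- vertex off the path from 1 is not the root, and no vertex of the path has parent 1.
  parentVia : Maybe (Fin n) → Maybe (Fin (suc n)) → Maybe (Fin n)
  parentVia nothing  nothing         = nothing
  parentVia nothing  (just fzero)    = nothing
  parentVia nothing  (just (fsuc u)) = just u
  parentVia (just M) nothing         = just M
  parentVia (just M) (just fzero)    = nothing
  parentVia (just M) (just (fsuc u)) with u Fin.<? M
  ... | yes _ = just u
  ... | no _  = just M

  Φ : Fun n
  Φ = tabulate (λ x → parentVia (pathMax x) (t (fsuc x)))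

  φ : Fin n → Maybe (Fin n)
  φ = lookup Φ

  φ≡parentVia : ∀ x → φ x ≡ parentVia (pathMax x) (t (fsuc x))
  φ≡parentVia = Vec.lookup∘tabulate _

  pathMax-just : ∀ {x M} → pathMax x ≡ just M → PathBelow x M × (∀ z → PathBelow x z → z Fin.≤ M)
  pathMax-just {x} found with below , above ← greatestWitness-just (pathBelow? x) found =
    below , λ z bz → ℕ.≮⇒≥ (λ M<z → above z M<z bz)

  pathMax-onPath : ∀ {x} → OnPath x → ∃ λ M → pathMax x ≡ just M
  pathMax-onPath {x} px with M , found , _ ← greatestWitness-≥ (pathBelow? x) (px , reach-refl f (fsuc x)) = M , found

  pathMax-offPath : ∀ {x} → ¬ OnPath x → pathMax x ≡ nothing
  pathMax-offPath {x} ¬px with pathMax x in found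
  ... | nothing = refl
  ... | just M with (pM , rMx) , _ ← pathMax-just found = ⊥-elim (¬px (reach-trans f pM rMx))

  pathMax-unique : ∀ {x M} → PathBelow x M → (∀ z → PathBelow x z → z Fin.≤ M) → pathMax x ≡ just M
  pathMax-unique {x} {M} bM below = greatestWitness-unique (pathBelow? x) bM (λ z M<z bz → ℕ.<⇒≱ M<z (below z bz))

  pathBelow-self : ∀ {x} → OnPath x → PathBelow x x
  pathBelow-self {x} px = px , reach-refl f (fsuc x)

  pathBelow-up : ∀ {x y z} → PathBelow y z → Reach f (fsuc y) (fsuc x) → PathBelow x z
  pathBelow-up (pz , r) r′ = pz , reach-trans f r r′

  pathMax-idem : ∀ {a M} → pathMax a ≡ just M → pathMax M ≡ just M
  pathMax-idem found with bM@(pM , _) , below ← pathMax-just found =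
    pathMax-unique (pathBelow-self pM) (λ z bz → below z (pathBelow-up bz (proj₂ bM)))

  PathRecord : Fin n → Set
  PathRecord y = OnPath y × (∀ z → PathBelow y z → z Fin.≤ y)

  pathMax-record : ∀ {x M} → pathMax x ≡ just M → PathRecord M
  pathMax-record found with (pM , rMx) , below ← pathMax-just found = pM , λ z bz → below z (pathBelow-up bz rMx)

  φ-offPath-sink : ∀ {x} → ¬ OnPath x → t (fsuc x) ≡ just fzero → φ x ≡ nothing
  φ-offPath-sink {x} ¬px e = trans (φ≡parentVia x) (cong₂ parentVia (pathMax-offPath ¬px) e)

  φ-offPath : ∀ {x u} → ¬ OnPath x → t (fsuc x) ≡ just (fsuc u) → φ x ≡ just u
  φ-offPath {x} ¬px e = trans (φ≡parentVia x) (cong₂ parentVia (pathMax-offPath ¬px) e)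

  φ-root : ∀ {x M} → pathMax x ≡ just M → t (fsuc x) ≡ nothing → φ x ≡ just M
  φ-root {x} found e = trans (φ≡parentVia x) (cong₂ parentVia found e)

  φ-below : ∀ {x M u} → pathMax x ≡ just M → t (fsuc x) ≡ just (fsuc u) → u Fin.< M → φ x ≡ just u
  φ-below {x} {M} {u} found e u<M = trans (φ≡parentVia x) (trans (cong₂ parentVia found e) keep)
    where
    keep : parentVia (just M) (just (fsuc u)) ≡ just u
    keep with u Fin.<? M
    ... | yes _   = refl
    ... | no u≮M = ⊥-elim (u≮M u<M)

  φ-close : ∀ {x M u} → pathMax x ≡ just M → t (fsuc x) ≡ just (fsuc u) → ¬ u Fin.< M → φ x ≡ just M
  φ-close {x} {M} {u} found e u≮M = trans (φ≡parentVia x) (trans (cong₂ parentVia found e) close)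
    where
    close : parentVia (just M) (just (fsuc u)) ≡ just M
    close with u Fin.<? M
    ... | yes u<M = ⊥-elim (u≮M u<M)
    ... | no _    = refl

  module _ (tree : IsRootedTree f) where

    falls-off : ∀ u → iter f (suc n) (just u) ≡ nothing
    falls-off u = All.lookup (proj₂ tree) (∈-allFin u)

    root-unique : ∀ {a b} → t a ≡ nothing → t b ≡ nothing → a ≡ b
    root-unique ea eb =
      count≡1⇒unique (λ j → t j ≟M nothing) (allFin (suc n)) (proj₁ tree) (∈-allFin _) (∈-allFin _) ea eb

    path-parent : ∀ {y w} → OnPath y → t (fsuc y) ≡ just w → ∃ λ u → w ≡ fsuc u × OnPath u
    path-parent {w = fzero}  py e = ⊥-elim (edge-irreversible f falls-off e py)
    path-parent {w = fsuc u} py e = u , refl , reach-snoc f py e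

    offPath-parent : ∀ {x} → ¬ OnPath x → ∃ λ w → t (fsuc x) ≡ just w
    offPath-parent {x} ¬px with nothing-or-just (t (fsuc x))
    ... | inj₂ edge = edge
    ... | inj₁ root with r , tr , r0 ← sink-reachable f (suc n) (falls-off fzero) with refl ← root-unique tr root =
      ⊥-elim (¬px r0)

    pathBelow-parent : ∀ {x u z} → OnPath x → t (fsuc x) ≡ just (fsuc u) → PathBelow u z → z ≡ u ⊎ PathBelow x z
    pathBelow-parent px tx (pz , r) with reach-unsnoc f r
    ... | inj₁ refl = inj₁ refl
    ... | inj₂ (fzero , r′ , _) with () ← reach-antisym f falls-off r′ pz
    ... | inj₂ (fsuc _ , r′ , tw) with refl ← parent-injective-along f falls-off (reach-trans f pz r′) px tw tx =
      inj₂ (pz , r′)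

    pathMax-below : ∀ {x u M} → OnPath x → t (fsuc x) ≡ just (fsuc u) → pathMax x ≡ just M → u Fin.< M → pathMax u ≡ just M
    pathMax-below px tx found u<M with bM , below ← pathMax-just found =
      pathMax-unique (pathBelow-up bM (reach-edge f tx)) below′
      where
      below′ : ∀ z → PathBelow _ z → z Fin.≤ _
      below′ z bz with pathBelow-parent px tx bz
      ... | inj₁ refl = ℕ.<⇒≤ u<M
      ... | inj₂ bxz  = below z bxz

    φ-path-step : ∀ {a b M} → OnPath a → pathMax a ≡ just M → φ a ≡ just b → OnPath b × pathMax b ≡ just M
    φ-path-step {a} pa found φa with bM , _ ← pathMax-just found | nothing-or-just (t (fsuc a))
    ... | inj₁ root with refl ← trans (sym φa) (φ-root found root) = proj₁ bM , pathMax-idem found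
    ... | inj₂ (w , ta) with u , refl , pu ← path-parent pa ta | u Fin.<? _
    ... | yes u<M with refl ← trans (sym φa) (φ-below found ta u<M) = pu , pathMax-below pa ta found u<M
    ... | no u≮M  with refl ← trans (sym φa) (φ-close found ta u≮M) = proj₁ bM , pathMax-idem found

    reach-φ-to-max : ∀ {u M} → OnPath u → pathMax u ≡ just M → Reach Φ u M
    reach-φ-to-max {u} pu found with r , tr , ur ← sink-reachable f (suc n) (falls-off (fsuc u)) =
      reach-ind-backward f ToMax atRoot climb ur refl pu found
      where
      ToMax : Fin (suc n) → Set
      ToMax v = ∀ {u M} → v ≡ fsuc u → OnPath u → pathMax u ≡ just M → Reach Φ u M
      atRoot : ToMax r
      atRoot refl _ found = reach-edge Φ (φ-root found tr)
      climb : ∀ {v w} → t v ≡ just w → Reach f w r → ToMax w → ToMax v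
      climb tv _ ih refl pu found with u′ , refl , pu′ ← path-parent pu tv | Fin.<-cmp u′ _
      ... | tri< u′<M _ _ = reach-cons Φ (φ-below found tv u′<M) (ih refl pu′ (pathMax-below pu tv found u′<M))
      ... | tri≈ _ refl _ = ⊥-elim (edge-irreversible f falls-off tv (proj₂ (proj₁ (pathMax-just found))))
      ... | tri> _ _ M<u′ = reach-edge Φ (φ-close found tv (ℕ.<⇒≯ M<u′))

    reach-φ-from-max : ∀ {x M} → pathMax x ≡ just M → Reach Φ M x
    reach-φ-from-max {x} {M} found with (pM , rMx) , below ← pathMax-just found =
      atX (reach-ind-forward f FromMax atMax descend rMx (reach-refl f (fsuc x)))
      where
      FromMax : Fin (suc n) → Set
      FromMax v = Reach f v (fsuc x) → ∃ λ w → v ≡ fsuc w × Reach Φ M w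
      atMax : FromMax (fsuc M)
      atMax _ = M , refl , reach-refl Φ M
      descend : ∀ {v v′} → Reach f (fsuc M) v → FromMax v → t v ≡ just v′ → FromMax v′
      descend rMv ih tv rv′x with w , refl , rMw ← ih (reach-cons f tv rv′x)
        with w′ , refl , pw′ ← path-parent (reach-trans f pM rMv) tv | Fin.<-cmp w′ M
      ... | tri< w′<M _ _ = w′ , refl , reach-snoc Φ rMw (φ-below stillM tv w′<M)
        where
        stillM : pathMax w ≡ just M
        stillM = pathMax-unique (pM , rMv) (λ z bz → below z (pathBelow-up bz (reach-cons f tv rv′x)))
      ... | tri≈ _ refl _ = ⊥-elim (edge-irreversible f falls-off tv rMv)
      ... | tri> _ _ M<w′ = ⊥-elim (ℕ.<⇒≱ M<w′ (below w′ (pw′ , rv′x)))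
      atX : (∃ λ w → fsuc x ≡ fsuc w × Reach Φ M w) → Reach Φ M x
      atX (_ , refl , rMx′) = rMx′

    open Cycles Φ using (OnCycle; CycleMax)

    onPath⇒onCycle : ∀ {x} → OnPath x → OnCycle x
    onPath⇒onCycle {x} px with M , found ← pathMax-onPath px | nothing-or-just (t (fsuc x))
    ... | inj₁ root = M , φ-root found root , reach-φ-from-max found
    ... | inj₂ (w , tx) with u , refl , pu ← path-parent px tx | u Fin.<? M
    ... | yes u<M = u , φ-below found tx u<M ,
                    reach-trans Φ (reach-φ-to-max pu (pathMax-below px tx found u<M)) (reach-φ-from-max found)
    ... | no u≮M  = M , φ-close found tx u≮M , reach-φ-from-max found

    offPath-reach : ∀ {a y} → ¬ OnPath y → Reach Φ a y → ¬ OnPath a × Reach f (fsuc a) (fsuc y)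
    offPath-reach {y = y} ¬py = reach-ind-backward Φ OffPathBelow (¬py , reach-refl f (fsuc y)) extend
      where
      OffPathBelow : Fin n → Set
      OffPathBelow a = ¬ OnPath a × Reach f (fsuc a) (fsuc y)
      extend : ∀ {a b} → φ a ≡ just b → Reach Φ b y → OffPathBelow b → OffPathBelow a
      extend {a} φa _ (¬pb , rb) = ¬pa , rest
        where
        ¬pa : ¬ OnPath a
        ¬pa pa with M , found ← pathMax-onPath pa = ¬pb (proj₁ (φ-path-step pa found φa))
        rest : Reach f (fsuc a) (fsuc y)
        rest with offPath-parent ¬pa
        ... | fzero  , ta with () ← trans (sym φa) (φ-offPath-sink ¬pa ta)
        ... | fsuc _ , ta with refl ← trans (sym φa) (φ-offPath ¬pa ta) = reach-cons f ta rb

    onCycle⇒onPath : ∀ {x} → OnCycle x → OnPath x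
    onCycle⇒onPath {x} (w , φx , rwx) with onPath? x
    ... | yes px = px
    ... | no ¬px with _ , rwx′ ← offPath-reach ¬px rwx | offPath-parent ¬px
    ... | fzero  , tx with () ← trans (sym φx) (φ-offPath-sink ¬px tx)
    ... | fsuc _ , tx with refl ← trans (sym φx) (φ-offPath ¬px tx) = ⊥-elim (edge-irreversible f falls-off tx rwx′)

    record⇒cycleMax : ∀ {y} → PathRecord y → CycleMax y
    record⇒cycleMax {y} (py , rec) =
      onPath⇒onCycle py , λ z r → bounded (reach-ind-forward Φ SameMax start (λ _ (pa , ea) → φ-path-step pa ea) r)
      where
      SameMax : Fin n → Set
      SameMax a = OnPath a × pathMax a ≡ just y
      start : SameMax y
      start = py , pathMax-unique (pathBelow-self py) rec
      bounded : ∀ {z} → SameMax z → z Fin.≤ y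
      bounded {z} (pz , found) = proj₂ (pathMax-just found) z (pathBelow-self pz)

    cycleMax⇒record : ∀ {y} → CycleMax y → PathRecord y
    cycleMax⇒record {y} (cy , above) with M , found ← pathMax-onPath (onCycle⇒onPath cy) =
      onCycle⇒onPath cy ,
      λ z bz → Fin.≤-trans (proj₂ (pathMax-just found) z bz) (above _ (reach-φ-to-max (onCycle⇒onPath cy) found))

    module T = ToTree Φ

    firstStep-above : ∀ {u z} → t fzero ≡ just (fsuc u) → OnPath z → Reach f (fsuc u) (fsuc z)
    firstStep-above t0 pz with reach-uncons f pz
    ... | inj₂ (_ , t0′ , r) with refl ← trans (sym t0) t0′ = r

    ψΦ-new : T.ψ fzero ≡ t fzero
    ψΦ-new with nothing-or-just (t fzero)
    ... | inj₁ root = trans (T.ψ≡parent fzero) (trans (cong (Maybe.map fsuc) none) (sym root))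
      where
      none : T.firstCycleMax ≡ nothing
      none = leastWitness-none _ (λ z mz → case sink-reach f root (proj₁ (cycleMax⇒record mz)) of λ ())
    ... | inj₂ (fzero  , t0) = ⊥-elim (falls-off⇒acyclic f falls-off fzero 0 t0)
    ... | inj₂ (fsuc u , t0) = trans (T.ψ-new first) (sym t0)
      where
      pu : OnPath u
      pu = reach-edge f t0
      first : T.firstCycleMax ≡ just u
      first = leastWitness-unique _ (record⇒cycleMax (pu , onlyU)) earlier
        where
        onlyU : ∀ z → PathBelow u z → z Fin.≤ u
        onlyU z (pz , rzu) = Fin.≤-reflexive (Fin.suc-injective (reach-antisym f falls-off rzu (firstStep-above t0 pz)))
        earlier : ∀ z → z Fin.< u → ¬ CycleMax z
        earlier z z<u mz with pz , recz ← cycleMax⇒record mz = ℕ.<⇒≱ z<u (recz u (pu , firstStep-above t0 pz))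

    ψΦ-offPath : ∀ {x} → ¬ OnPath x → T.ψ (fsuc x) ≡ t (fsuc x)
    ψΦ-offPath ¬px with offPath-parent ¬px
    ... | fzero  , tx = trans (T.ψ-sink (φ-offPath-sink ¬px tx)) (sym tx)
    ... | fsuc _ , tx = trans (T.ψ-offCycle (¬px ∘ onCycle⇒onPath) (φ-offPath ¬px tx)) (sym tx)

    module _ {x M} (px : OnPath x) (found : pathMax x ≡ just M) where

      private
        bM = proj₁ (pathMax-just found)
        below = proj₂ (pathMax-just found)
        cx = onPath⇒onCycle px
        mM = record⇒cycleMax (pathMax-record found)

      ψΦ-root : t (fsuc x) ≡ nothing → T.ψ (fsuc x) ≡ t (fsuc x)
      ψΦ-root root = trans (T.ψ-intoMax cx (φ-root found root) mM) (trans (cong (Maybe.map fsuc) none) (sym root))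
        where
        none : T.nextCycleMax M ≡ nothing
        none = leastWitness-none _ λ z (M<z , mz) → ℕ.<⇒≱ M<z (bounded (proj₁ (cycleMax⇒record mz)))
          where
          bounded : ∀ {z} → OnPath z → z Fin.≤ M
          bounded pz with reach-comparable f pz px
          ... | inj₁ rzx = below _ (pz , rzx)
          ... | inj₂ rxz with refl ← Fin.suc-injective (sink-reach f root rxz) = below x (pathBelow-self px)

      ψΦ-below : ∀ {u} → t (fsuc x) ≡ just (fsuc u) → u Fin.< M → T.ψ (fsuc x) ≡ t (fsuc x)
      ψΦ-below tx u<M = trans (T.ψ-nonMax (φ-below found tx u<M) notMax) (sym tx)
        where
        notMax : ¬ CycleMax _
        notMax mu = ℕ.<⇒≱ u<M (proj₂ (cycleMax⇒record mu) M (pathBelow-up bM (reach-edge f tx)))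

      ψΦ-close : ∀ {u} → t (fsuc x) ≡ just (fsuc u) → ¬ u Fin.< M → T.ψ (fsuc x) ≡ t (fsuc x)
      ψΦ-close {u} tx u≮M = trans (T.ψ-intoMax cx (φ-close found tx u≮M) mM) (trans (cong (Maybe.map fsuc) next) (sym tx))
        where
        pu : OnPath u
        pu = reach-snoc f px tx
        M<u : M Fin.< u
        M<u with Fin.<-cmp u M
        ... | tri< u<M _ _ = ⊥-elim (u≮M u<M)
        ... | tri≈ _ refl _ = ⊥-elim (edge-irreversible f falls-off tx (proj₂ bM))
        ... | tri> _ _ M<u = M<u
        recordU : PathRecord u
        recordU = pu , λ z bz → case pathBelow-parent px tx bz of λ
          { (inj₁ refl) → Fin.≤-refl
          ; (inj₂ bxz)  → ℕ.<⇒≤ (ℕ.≤-<-trans (below z bxz) M<u) }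
        between : ∀ z → z Fin.< u → ¬ (M Fin.< z × CycleMax z)
        between z z<u (M<z , mz) with pz , recz ← cycleMax⇒record mz | reach-comparable f (proj₁ (cycleMax⇒record mz)) px
        ... | inj₁ rzx = ℕ.<⇒≱ M<z (below z (pz , rzx))
        ... | inj₂ rxz with reach-uncons f rxz
        ...   | inj₁ refl = ℕ.<⇒≱ M<z (below x (pathBelow-self px))
        ...   | inj₂ (_ , tx′ , rz) with refl ← trans (sym tx) tx′ = ℕ.<⇒≱ z<u (recz u (pu , rz))
        next : T.nextCycleMax M ≡ just u
        next = leastWitness-unique _ (M<u , record⇒cycleMax recordU) between

    ψΦ-pointwise : ∀ v → T.ψ v ≡ t v
    ψΦ-pointwise fzero = ψΦ-new
    ψΦ-pointwise (fsuc x) with onPath? x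
    ... | no ¬px = ψΦ-offPath ¬px
    ... | yes px with M , found ← pathMax-onPath px | nothing-or-just (t (fsuc x))
    ... | inj₁ root = ψΦ-root px found root
    ... | inj₂ (w , tx) with u , refl , _ ← path-parent px tx | u Fin.<? M
    ... | yes u<M = ψΦ-below px found tx u<M
    ... | no u≮M  = ψΦ-close px found tx u≮M

    Ψ∘Φ : T.Ψ ≡ f
    Ψ∘Φ = trans (Vec.tabulate-cong (λ v → trans (sym (T.ψ≡parent v)) (ψΦ-pointwise v))) (Vec.tabulate∘lookup f)

module Inverse {n : ℕ} (G : Fun n) where
  open Cycles G
  open ToTree G
  module P = ToPFD Ψ

  pathMax≡maxOfCycle : ∀ {x} → OnCycle x → P.pathMax x ≡ maxOfCycle x
  pathMax≡maxOfCycle {x} cx with c , found , mc , _ , rcx ← maxOfCycle-spec cx =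
    trans (P.pathMax-unique (reach-cycleMax mc , reach-around-cycle mc rcx) below) (sym found)
    where
    below : ∀ z → P.PathBelow x z → z Fin.≤ c
    below z (pz , rzx) with cz , foundz , mcz , rzcz , _ ← maxOfCycle-spec (spine-closed tt pz) =
      Fin.≤-trans (proj₂ mcz z (onCycle-reach-back (spine-closed tt pz) rzcz))
                  (radix-≤ K potential≤ (0<offset z cz) (offset≤K x c))
      where
      potential≤ : K ℕ.* toℕ cz + offset z cz ℕ.≤ K ℕ.* toℕ c + offset x c
      potential≤ = subst₂ ℕ._≤_ (potential-onCycle foundz) (potential-onCycle found)
                          (potential-reach (spine-closed tt pz) rzx)

  φΨ-pointwise : ∀ x → P.φ x ≡ g x
  φΨ-pointwise x with onCycle? x
  ... | no ¬cx = offCycle (sink-or-edge x)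
    where
    ¬px : ¬ P.OnPath x
    ¬px = ¬cx ∘ spine-closed tt
    offCycle : g x ≡ nothing ⊎ (∃ λ y → g x ≡ just y) → P.φ x ≡ g x
    offCycle (inj₁ gx)       = trans (P.φ-offPath-sink ¬px (ψ-sink gx)) (sym gx)
    offCycle (inj₂ (_ , gx)) = trans (P.φ-offPath ¬px (ψ-offCycle ¬cx gx)) (sym gx)
  ... | yes cx@(y , gx , _) with c , found , mc , rxc , rcx ← maxOfCycle-spec cx | cycleMax? y
  ... | no ¬my = trans (P.φ-below (trans (pathMax≡maxOfCycle cx) found) (ψ-nonMax gx ¬my) y<c) (sym gx)
    where
    y<c : y Fin.< c
    y<c = Fin.≤∧≢⇒< (proj₂ mc y (reach-trans G rcx (reach-edge G gx))) (λ { refl → ¬my mc })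
  ... | yes my with refl ← cycleMax-unique my mc (reach-trans G (onCycle-reach-back cx (reach-edge G gx)) rxc)
                  | nothing-or-just (nextCycleMax y)
  ... | inj₁ none = trans (P.φ-root (trans (pathMax≡maxOfCycle cx) found) root) (sym gx)
    where
    root : ψ (fsuc x) ≡ nothing
    root = trans (ψ-intoMax cx gx my) (cong (Maybe.map fsuc) none)
  ... | inj₂ (z , next) = trans (P.φ-close (trans (pathMax≡maxOfCycle cx) found) redirected z≮y) (sym gx)
    where
    redirected : ψ (fsuc x) ≡ just (fsuc z)
    redirected = trans (ψ-intoMax cx gx my) (cong (Maybe.map fsuc) next)
    z≮y : ¬ z Fin.< y
    z≮y = ℕ.<⇒≯ (proj₁ (proj₁ (leastWitness-just _ next)))

  Φ∘Ψ : P.Φ ≡ G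
  Φ∘Ψ = trans (Vec.tabulate-cong (λ x → trans (sym (P.φ≡parentVia x)) (φΨ-pointwise x))) (Vec.tabulate∘lookup G)

-- The bijection and the weights

module _ {A : Set} (xs : List A) where

  allVecs≡cartesianProduct : ∀ n → allVecs xs (suc n) ≡ cartesianProductWith _∷_ xs (allVecs xs n)
  allVecs≡cartesianProduct n = go xs
    where
    go : ∀ ys → concatMap (λ y → map (y ∷_) (allVecs xs n)) ys ≡ cartesianProductWith _∷_ ys (allVecs xs n)
    go []       = refl
    go (y ∷ ys) = cong (map (y ∷_) (allVecs xs n) ++_) (go ys)

  allVecs-unique : Unique xs → ∀ n → Unique (allVecs xs n)
  allVecs-unique u zero    = [] ∷ []
  allVecs-unique u (suc n) = subst Unique (sym (allVecs≡cartesianProduct n))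
    (Unique.cartesianProductWith⁺ _∷_ Vec.∷-injective u (allVecs-unique u n))

  allVecs-complete : (∀ a → a ∈ xs) → ∀ {n} (v : Vec A n) → v ∈ allVecs xs n
  allVecs-complete complete []      = here refl
  allVecs-complete complete (a ∷ v) = subst (_ ∈_) (sym (allVecs≡cartesianProduct _))
    (∈-cartesianProductWith⁺ _∷_ (complete a) (allVecs-complete complete v))

allFuns-unique : ∀ m → Unique (allFuns m)
allFuns-unique m = allVecs-unique _ (All.tabulate nothing∉ ∷ Unique.map⁺ just-injective (Unique.allFin⁺ m)) m
  where
  nothing∉ : ∀ {x} → x ∈ map just (allFin m) → nothing ≢ x
  nothing∉ x∈ refl with _ , _ , () ← ∈-map⁻ just x∈

allFuns-complete : ∀ m (h : Fun m) → h ∈ allFuns m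
allFuns-complete m = allVecs-complete _ every
  where
  every : ∀ a → a ∈ nothing ∷ map just (allFin m)
  every nothing  = here refl
  every (just i) = there (∈-map⁺ just (∈-allFin i))

treeOf : ∀ {n} → Fun n → Fun (suc n)
treeOf G = ToTree.Ψ G

treeOf-injective : ∀ {n} {G G′ : Fun n} → treeOf G ≡ treeOf G′ → G ≡ G′
treeOf-injective {G = G} {G′} e = trans (sym (Inverse.Φ∘Ψ G)) (trans (cong ToPFD.Φ e) (Inverse.Φ∘Ψ G′))

treeOf-pfds↭trees1k : ∀ n k → map treeOf (pfds n k) ↭ trees1k n k
treeOf-pfds↭trees1k n k = ∼bag⇒↭ (unique∧set⇒bag
  (Unique.map⁺ treeOf-injective (Unique.filter⁺ _ (allFuns-unique n))) (Unique.filter⁺ _ (allFuns-unique (suc n)))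
  (mk⇔ to from))
  where
  InTrees? = λ f → isRootedTree? f ×-dec ℕ._≟_ (nChildren f fzero) k
  InPfds?  = λ G → ℕ._≟_ (nNothing G) k
  to : ∀ {f} → f ∈ map treeOf (pfds n k) → f ∈ trees1k n k
  to f∈ with G , G∈ , refl ← ∈-map⁻ treeOf f∈ with _ , sinks ← ∈-filter⁻ InPfds? {xs = allFuns n} G∈ =
    ∈-filter⁺ InTrees? (allFuns-complete (suc n) (treeOf G)) (ToTree.Ψ-rootedTree G , trans (ToTree.nChildren-new G) sinks)
  from : ∀ {f} → f ∈ trees1k n k → f ∈ map treeOf (pfds n k)
  from {f} f∈ with _ , tree , children ← ∈-filter⁻ InTrees? {xs = allFuns (suc n)} f∈ =
    subst (_∈ map treeOf (pfds n k)) Ψ∘Φ (∈-map⁺ treeOf (∈-filter⁺ InPfds? (allFuns-complete n (ToPFD.Φ f)) sinks))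
    where
    Ψ∘Φ : treeOf (ToPFD.Φ f) ≡ f
    Ψ∘Φ = ToPFD.Ψ∘Φ f tree
    sinks : nNothing (ToPFD.Φ f) ≡ k
    sinks = trans (sym (ToTree.nChildren-new (ToPFD.Φ f))) (trans (cong (λ h → nChildren h fzero) Ψ∘Φ) children)

module Weights {c ℓ} (R : CommutativeSemiring c ℓ) where
  open CommutativeSemiring R using (Carrier; _≈_; _*_; setoid; isEquivalence; +-isCommutativeMonoid)
  open Poly R

  sumR-↭ : ∀ {A : Set} (w : A → Carrier) {xs ys : List A} → xs ↭ ys → sumR (map w xs) ≈ sumR (map w ys)
  sumR-↭ w p =
    PermutationSetoid.foldr-commMonoid setoid +-isCommutativeMonoid (↭⇒↭ₛ′ isEquivalence (Permutation.map⁺ w p))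

  module _ (y : Carrier) (φ : ℕ → Carrier) {n : ℕ} where

    treeWeight : Fun (suc n) → Carrier
    treeWeight f = (y ^ impropeT f) * prod (map (λ i → phihat φ (pdegT f (fsuc i))) (allFin n))

    pfdWeight : Fun n → Carrier
    pfdWeight G = (y ^ impropeG G) * prod (map (λ i → phihat φ (pindegG G i)) (allFin n))

    pfdWeight≡treeWeight : ∀ G → pfdWeight G ≡ treeWeight (treeOf G)
    pfdWeight≡treeWeight G = cong₂ _*_ (cong (y ^_) (sym (ToTree.impropeT-Ψ G)))
      (cong prod (List.map-cong (λ i → cong (phihat φ) (sym (ToTree.pdegT-Ψ G i))) (allFin n)))

proposition1p7 : ∀ {c ℓ} (R : CommutativeSemiring c ℓ) (y : CommutativeSemiring.Carrier R) (φ : ℕ → CommutativeSemiring.Carrier R) (n k : ℕ) → k ≤ n → CommutativeSemiring._≈_ R (Poly.t R n k y φ) (Poly.tt R n k y φ)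
proposition1p7 R y φ n k _ = CommutativeSemiring.sym R (begin
  t̃ n k y φ                                          ≡⟨ cong sumR (List.map-cong (pfdWeight≡treeWeight y φ) (pfds n k)) ⟩
  sumR (map (treeWeight y φ ∘ treeOf) (pfds n k))    ≡⟨ cong sumR (List.map-∘ (pfds n k)) ⟩
  sumR (map (treeWeight y φ) (map treeOf (pfds n k))) ≈⟨ sumR-↭ (treeWeight y φ) (treeOf-pfds↭trees1k n k) ⟩
  t n k y φ                                          ∎)
  where
  open Poly R using (t; sumR) renaming (tt to t̃)
  open Weights R
  open import Relation.Binary.Reasoning.Setoid (CommutativeSemiring.setoid R)
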